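{- In the setting described in the context, let $j<v$ and let $\sigma\in\mathfrak{S}_A$ be a permutation fixing all entries of $S$ contained in its first $v-1$ columns. Then \[\mathfrak{a}_\lambda(T)\cdot\mathfrak{c}_\mu(S)\cdot\sigma\cdot(1-z_j)=0.\]
   Context: $\mathbb{K}$ is a field of characteristic zero; permutations are multiplied by composition; $(a,b)$ is a transposition. A Young tableau of shape $\lambda$ with entries in $A$ is a bijection $D_\lambda\to A$, $D_\lambda=\{(i,j):1\leq j\leq\lambda_i\}$, with rows $R_i$ and columns $C_j$. $\mathfrak{a}(X)=\sum_{\sigma\in\mathfrak{S}_X}\sigma$, $\mathfrak{b}(X)=\sum_{\tau\in\mathfrak{S}_X}\mathrm{sgn}(\tau)\tau$, $\mathfrak{a}_\lambda(T)=\prod_i\mathfrak{a}(R_i(T))$, $\mathfrak{c}_\mu(S)=\prod_i\mathfrak{a}(R_i(S))\cdot\prod_j\mathfrak{b}(C_j(S))$. Setting: $A$ is a set with $|A|=n$, $S$ is a Young tableau of shape $\mu\vdash n-1$ with entries in $A$, and $T$ is obtained from $S$ by adding one box in position $(u,v)$ with entry $a\in A$ (the element not in $S$), so $T$ has shape $\lambda$ with $\lambda_i=\mu_i$ for $i\neq u$ and $\lambda_u=v=\mu_u+1$. For $1\leq j\leq\mu_1$, $z_j=\sum_{b\in C_j(S)}(a,b)$. -}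

module Defs where

open import Level using (Level; _⊔_)
open import Data.Bool using (Bool; true; false; if_then_else_; _∧_; _∨_; not)
open import Data.Nat as ℕ using (ℕ; zero; suc; _≤_; _<_; _≥_)
open import Data.Fin as F using (Fin)
open import Data.Fin.Properties using () renaming (_≟_ to _≟F_)
open import Data.Vec as V using (Vec; []; _∷_)
open import Data.List as L using (List; []; _∷_; _++_; map; concatMap; foldr; filter; allFin; length; concat)
open import Data.List.Relation.Unary.All using (All)
open import Data.List.Relation.Unary.Linked using (Linked)
open import Data.List.Membership.Propositional using (_∈_)
open import Data.Nat.ListAction using () renaming (sum to sumℕ)
open import Data.Maybe using (Maybe; just; nothing)
open import Data.Product using (_×_; _,_; ∃-syntax)
open import Relation.Nullary using (¬_; does)
open import Relation.Binary.PropositionalEquality using (_≡_)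
open import Algebra.Bundles using (CommutativeRing)
open import Function using (_∘_; id)

private variable
  a : Level
  X : Set a

-- Lists / Young tableaux (tableau = list of rows, 1-indexed rows/columns)

nth : ℕ → List X → Maybe X
nth zero      _        = nothing
nth (suc _)   []       = nothing
nth (suc zero) (x ∷ _) = just x
nth (suc (suc k)) (_ ∷ xs) = nth (suc k) xs

maybeToList : Maybe X → List X
maybeToList nothing  = []
maybeToList (just x) = x ∷ []

shape : List (List X) → List ℕ
shape = map length

IsPartition : List ℕ → Set
IsPartition μ = All (λ k → 1 ≤ k) μ × Linked _≥_ μ

firstPart : List ℕ → ℕ
firstPart []      = 0
firstPart (k ∷ _) = k

rowLen : ℕ → List (List X) → ℕ
rowLen u S with nth u S
... | just r  = length r
... | nothing = 0

col : ℕ → List (List X) → List X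
col j S = concatMap (λ r → maybeToList (nth j r)) S

addBox : ℕ → X → List (List X) → List (List X)
addBox zero          x S        = S
addBox (suc zero)    x []       = (x ∷ []) ∷ []
addBox (suc zero)    x (r ∷ S)  = (r ++ x ∷ []) ∷ S
addBox (suc (suc u)) x []       = []
addBox (suc (suc u)) x (r ∷ S)  = r ∷ addBox (suc u) x S

module _ {n : ℕ} where

  _==_ : Fin n → Fin n → Bool
  i == j = does (i ≟F j)

  allB : (Fin n → Bool) → Bool
  allB p = foldr (λ i b → p i ∧ b) true (allFin n)

  eqMap : (Fin n → Fin n) → (Fin n → Fin n) → Bool
  eqMap f g = allB (λ i → f i == g i)

  injB : (Fin n → Fin n) → Bool
  injB f = allB (λ i → allB (λ j → not (f i == f j) ∨ (i == j)))

  memB : Fin n → List (Fin n) → Bool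
  memB x = foldr (λ y b → (x == y) ∨ b) false

  transp : Fin n → Fin n → Fin n → Fin n
  transp x y i = if i == x then y else (if i == y then x else i)

  inversions : (Fin n → Fin n) → ℕ
  inversions f = sumℕ (map (λ i → sumℕ (map (λ j →
      if does (i F.<? j) ∧ does (f j F.<? f i) then 1 else 0) (allFin n))) (allFin n))

allVecs : (n k : ℕ) → List (Vec (Fin n) k)
allVecs n zero    = [] ∷ []
allVecs n (suc k) = concatMap (λ x → map (x ∷_) (allVecs n k)) (allFin n)

allMaps : (n : ℕ) → List (Fin n → Fin n)
allMaps n = map V.lookup (allVecs n n)

-- 𝔖_X ⊆ 𝔖_A (A = Fin n): bijections of Fin n fixing every point outside X
symGroup : (n : ℕ) → List (Fin n) → List (Fin n → Fin n)
symGroup n X = filter (λ f → Data.Bool.T? (injB f ∧ allB (λ i → memB i X ∨ (f i == i)))) (allMaps n)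
  where import Data.Bool

even : ℕ → Bool
even zero = true
even (suc k) = not (even k)

-- Group algebra R[𝔖_n] as formal finite sums  Σ c_k · f_k

module GroupAlgebra {c ℓ} (R : CommutativeRing c ℓ) (n : ℕ) where
  open CommutativeRing R

  Perm : Set
  Perm = Fin n → Fin n

  GA : Set c
  GA = List (Carrier × Perm)

  coeff : GA → Perm → Carrier
  coeff x g = foldr (λ { (c , f) s → (if eqMap f g then c else 0#) + s }) 0# x

  IsZero : GA → Set ℓ
  IsZero x = ∀ (g : Perm) → coeff x g ≈ 0#

  one : GA
  one = (1# , id) ∷ []

  single : Perm → GA
  single f = (1# , f) ∷ []

  _⊕_ : GA → GA → GA
  _⊕_ = _++_

  _⊗_ : GA → GA → GA
  x ⊗ y = concatMap (λ { (c , f) → map (λ { (d , g) → (c * d , f ∘ g) }) y }) x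

  prod : List GA → GA
  prod = foldr _⊗_ one

  sgn : Perm → Carrier
  sgn f = if even (inversions f) then 1# else - 1#

  𝔞 : List (Fin n) → GA
  𝔞 X = map (λ f → (1# , f)) (symGroup n X)

  𝔟 : List (Fin n) → GA
  𝔟 X = map (λ f → (sgn f , f)) (symGroup n X)

  𝔞row : List (List (Fin n)) → GA
  𝔞row T = prod (map 𝔞 T)

  𝔠 : List (List (Fin n)) → GA
  𝔠 S = 𝔞row S ⊗ prod (map (λ j → 𝔟 (col j S)) (L.map suc (L.upTo (firstPart (shape S)))))

  z : Fin n → ℕ → List (List (Fin n)) → GA
  z x j S = map (λ b → (1# , transp x b)) (col j S)

  oneMinus : GA → GA
  oneMinus y = one ⊕ map (λ { (c , f) → (- c , f) }) y

module _ {c ℓ} (R : CommutativeRing c ℓ) where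
  open CommutativeRing R

  natCast : ℕ → Carrier
  natCast zero    = 0#
  natCast (suc m) = 1# + natCast m

  IsField : Set (c ⊔ ℓ)
  IsField = (¬ (1# ≈ 0#)) × (∀ x → ¬ (x ≈ 0#) → ∃[ y ] (x * y ≈ 1#))

  CharZero : Set ℓ
  CharZero = ∀ m → ¬ (natCast (suc m) ≈ 0#)

-- Write C = C_j(S) and d = σa.  Since σ fixes C pointwise, σ(1 - ∑_{b∈C} (a b)) = (1 - ∑_{b∈C} (d b))σ,
-- and d ∉ C, so 𝔟(C)(1 - ∑_{b∈C} (d b)) = 𝔟(C ∪ {d}).  The row symmetrizers of S are absorbed by 𝔞_λ(T),
-- and the antisymmetrizers of the other columns commute with 𝔟(C); each of their terms q fixes C and sends
-- d to a or to an entry of S right of column j.  That entry e shares a row of T with some b′ ∈ C, so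
-- 𝔞_λ(T) absorbs (e b′) = q (d b′) q⁻¹, while (d b′) 𝔟(C ∪ {d}) = -𝔟(C ∪ {d}).  Each term thus equals its
-- own negative, and vanishes because 2 is invertible in K.

module Submission where

open import Defs
open import Level using (Level; _⊔_)
open import Algebra.Bundles using (CommutativeMonoid; CommutativeRing)
open import Data.Bool using (Bool; true; false; if_then_else_; _∧_; _∨_; not; T?)
open import Data.Bool.Properties using (not-involutive; T-≡)
open import Data.Empty using (⊥-elim)
open import Data.Fin as F using (Fin; zero; suc; toℕ)
open import Data.Fin.Permutation using (Permutation′; _⟨$⟩ʳ_; _⟨$⟩ˡ_; inverseˡ; inverseʳ)
open import Data.Fin.Properties using (any?; pigeonhole; punchOut-injective; toℕ-injective; toℕ<n; toℕ-fromℕ<)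
  renaming (_≟_ to _≟F_)
open import Data.List as L using (List; []; _∷_; _++_; map; concatMap; concat; foldr; allFin; filter; length; upTo; tabulate)
open import Data.List.Properties using (map-tabulate; map-cong)
open import Data.List.Membership.Propositional using (_∈_; _∉_)
open import Data.List.Membership.Propositional.Properties using (∈-allFin; ∈-concat⁺′; ∈-concat⁻′; ∈-++⁺ˡ; ∈-++⁺ʳ; ∈-++⁻; ∈-map⁺; ∈-upTo⁺)
open import Data.List.Relation.Binary.Disjoint.Propositional using (Disjoint)
open import Data.List.Relation.Binary.Pointwise using (Pointwise; []; _∷_)
open import Data.List.Relation.Unary.All as All using (All; []; _∷_)
import Data.List.Relation.Unary.All.Properties as Allₚ
open import Data.List.Relation.Unary.AllPairs using ([]; _∷_)
open import Data.List.Relation.Unary.Any using (here; there)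
open import Data.List.Relation.Unary.Unique.Propositional using (Unique)
import Data.List.Relation.Unary.Unique.Propositional.Properties as Uniqueₚ
open import Data.Maybe using (just; nothing)
open import Data.Maybe.Properties using (just-injective)
open import Data.Nat as ℕ using (ℕ; zero; suc; _<_; _≤_; s≤s; z≤n)
import Data.Nat.Properties as ℕₚ
open import Data.Nat.ListAction using () renaming (sum to sumℕ)
open import Data.Product using (_×_; _,_; proj₁; proj₂; ∃)
open import Data.Sum using (_⊎_; inj₁; inj₂)
open import Data.Vec as V using (Vec; []; _∷_)
open import Function using (_∘_; id; case_of_)
open import Function.Bundles using (Equivalence)
open import Function.Definitions using (Injective)
open import Relation.Binary.Bundles using (Setoid)
open import Relation.Binary.Definitions using (tri<; tri≈; tri>)
open import Relation.Binary.PropositionalEquality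
  using (_≡_; _≢_; _≗_; refl; sym; trans; cong; cong₂; subst; module ≡-Reasoning)
open import Relation.Nullary using (¬_; Dec; yes; no; does)

private variable
  a : Level
  A : Set a

Unique-++⁻ : (xs : List A) {ys : List A} → Unique (xs ++ ys) → Unique xs × Unique ys × Disjoint xs ys
Unique-++⁻ []       u = [] , u , λ ()
Unique-++⁻ (x ∷ xs) (x∉ ∷ u) with Unique-++⁻ xs u
... | xs-unique , ys-unique , xs#ys = Allₚ.++⁻ˡ xs x∉ ∷ xs-unique , ys-unique , λ where
  (here refl  , x∈ys) → All.lookup x∉ (∈-++⁺ʳ xs x∈ys) refl
  (there v∈xs , v∈ys) → xs#ys (v∈xs , v∈ys)

bool-ext : ∀ {b b′ : Bool} → (b ≡ true → b′ ≡ true) → (b′ ≡ true → b ≡ true) → b ≡ b′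
bool-ext {false} {false} _ _ = refl
bool-ext {false} {true}  _ g = g refl
bool-ext {true}  {false} f _ = sym (f refl)
bool-ext {true}  {true}  _ _ = refl

∧-true : ∀ {b b′} → (b ∧ b′) ≡ true → b ≡ true × b′ ≡ true
∧-true {true} e = refl , e

true-∧ : ∀ {b b′} → b ≡ true → b′ ≡ true → (b ∧ b′) ≡ true
true-∧ refl refl = refl

∨-true : ∀ {b b′} → (b ∨ b′) ≡ true → b ≡ true ⊎ b′ ≡ true
∨-true {true}  _ = inj₁ refl
∨-true {false} e = inj₂ e

true-∨ˡ : ∀ {b b′} → b ≡ true → (b ∨ b′) ≡ true
true-∨ˡ refl = refl

true-∨ʳ : ∀ {b b′} → b′ ≡ true → (b ∨ b′) ≡ true
true-∨ʳ {true}  _ = refl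
true-∨ʳ {false} e = e

true⇒not≢true : ∀ {b} → b ≡ true → not b ≢ true
true⇒not≢true refl ()

all-foldr : (P : A → Bool) (xs : List A) → foldr (λ x b → P x ∧ b) true xs ≡ true → All (λ x → P x ≡ true) xs
all-foldr P []       _ = []
all-foldr P (x ∷ xs) e = proj₁ (∧-true e) ∷ all-foldr P xs (proj₂ (∧-true {P x} e))

foldr-all : (P : A → Bool) (xs : List A) → All (λ x → P x ≡ true) xs → foldr (λ x b → P x ∧ b) true xs ≡ true
foldr-all P []       []       = refl
foldr-all P (x ∷ xs) (e ∷ es) = true-∧ e (foldr-all P xs es)

module _ {n : ℕ} where

  ==⇒≡ : {i j : Fin n} → (i == j) ≡ true → i ≡ j
  ==⇒≡ {i} {j} e with i ≟F j
  ... | yes i≡j = i≡j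

  ==-refl : (i : Fin n) → (i == i) ≡ true
  ==-refl i with i ≟F i
  ... | yes _  = refl
  ... | no i≢i = ⊥-elim (i≢i refl)

  ≡⇒== : {i j : Fin n} → i ≡ j → (i == j) ≡ true
  ≡⇒== {i} refl = ==-refl i

  ≢⇒==false : {i j : Fin n} → i ≢ j → (i == j) ≡ false
  ≢⇒==false {i} {j} i≢j with i ≟F j
  ... | yes i≡j = ⊥-elim (i≢j i≡j)
  ... | no _    = refl

  allB⇒∀ : (P : Fin n → Bool) → allB P ≡ true → ∀ i → P i ≡ true
  allB⇒∀ P e i = All.lookup (all-foldr P (allFin n) e) (∈-allFin i)

  ∀⇒allB : (P : Fin n → Bool) → (∀ i → P i ≡ true) → allB P ≡ true
  ∀⇒allB P h = foldr-all P (allFin n) (All.tabulate (λ {i} _ → h i))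

  eqMap⇒≗ : {f g : Fin n → Fin n} → eqMap f g ≡ true → f ≗ g
  eqMap⇒≗ {f} {g} e i = ==⇒≡ (allB⇒∀ _ e i)

  ≗⇒eqMap : {f g : Fin n → Fin n} → f ≗ g → eqMap f g ≡ true
  ≗⇒eqMap {f} {g} f≗g = ∀⇒allB _ (λ i → ≡⇒== (f≗g i))

  eqMap-cong : {f f′ g g′ : Fin n → Fin n} → f ≗ f′ → g ≗ g′ → eqMap f g ≡ eqMap f′ g′
  eqMap-cong {f} {f′} {g} {g′} f≗f′ g≗g′ = bool-ext
    (λ e → ≗⇒eqMap (λ i → trans (sym (f≗f′ i)) (trans (eqMap⇒≗ {f} {g} e i) (g≗g′ i))))
    (λ e → ≗⇒eqMap (λ i → trans (f≗f′ i) (trans (eqMap⇒≗ {f′} {g′} e i) (sym (g≗g′ i)))))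

  injB⇒injective : (f : Fin n → Fin n) → injB f ≡ true → Injective _≡_ _≡_ f
  injB⇒injective f e {i} {j} fi≡fj
    with ∨-true (allB⇒∀ _ (allB⇒∀ (λ i → allB (λ j → not (f i == f j) ∨ (i == j))) e i) j)
  ... | inj₂ i==j = ==⇒≡ i==j
  ... | inj₁ fi≠fj = ⊥-elim (true⇒not≢true (≡⇒== fi≡fj) fi≠fj)

  injective⇒injB : (f : Fin n → Fin n) → Injective _≡_ _≡_ f → injB f ≡ true
  injective⇒injB f inj = ∀⇒allB _ (λ i → ∀⇒allB _ (λ j → pair i j))
    where
    pair : ∀ i j → (not (f i == f j) ∨ (i == j)) ≡ true
    pair i j with i ≟F j
    ... | yes refl = true-∨ʳ {not (f i == f i)} refl
    ... | no i≢j rewrite ≢⇒==false (i≢j ∘ inj) = refl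

  memB⇒∈ : (x : Fin n) (X : List (Fin n)) → memB x X ≡ true → x ∈ X
  memB⇒∈ x (y ∷ X) e with ∨-true {x == y} e
  ... | inj₁ x==y = here (==⇒≡ x==y)
  ... | inj₂ x∈X  = there (memB⇒∈ x X x∈X)

  ∈⇒memB : (x : Fin n) (X : List (Fin n)) → x ∈ X → memB x X ≡ true
  ∈⇒memB x (y ∷ X) (here refl) = true-∨ˡ (==-refl x)
  ∈⇒memB x (y ∷ X) (there x∈X) = true-∨ʳ {x == y} (∈⇒memB x X x∈X)

  _∈?_ : (x : Fin n) (X : List (Fin n)) → Dec (x ∈ X)
  x ∈? X = Data.List.Membership.DecPropositional._∈?_ _≟F_ x X
    where import Data.List.Membership.DecPropositional

injective⇒surjective : ∀ {n} (f : Fin n → Fin n) → Injective _≡_ _≡_ f → ∀ y → ∃ λ x → f x ≡ y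
injective⇒surjective {n} f inj y with any? (λ x → f x ≟F y)
... | yes hit = hit
injective⇒surjective {suc m} f inj y | no miss = ⊥-elim (collision (pigeonhole (ℕₚ.n<1+n m) (λ x → F.punchOut (y≢f x))))
  where
  y≢f : ∀ x → y ≢ f x
  y≢f x e = miss (x , sym e)
  collision : ¬ ∃ λ i → ∃ λ j → i F.< j × F.punchOut (y≢f i) ≡ F.punchOut (y≢f j)
  collision (i , j , i<j , e) = ℕₚ.<-irrefl (cong toℕ (inj (punchOut-injective (y≢f i) (y≢f j) e))) i<j

module _ {n : ℕ} where

  record Invertible (f : Fin n → Fin n) : Set where
    constructor invertible
    field
      inv   : Fin n → Fin n
      f∘inv : ∀ i → f (inv i) ≡ i
      inv∘f : ∀ i → inv (f i) ≡ i
  open Invertible public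

  id-invertible : Invertible id
  id-invertible = invertible id (λ _ → refl) (λ _ → refl)

  ∘-invertible : {f g : Fin n → Fin n} → Invertible f → Invertible g → Invertible (f ∘ g)
  ∘-invertible {f} {g} bf bg = invertible (inv bg ∘ inv bf)
    (λ i → trans (cong f (f∘inv bg _)) (f∘inv bf i))
    (λ i → trans (cong (inv bg) (inv∘f bf _)) (inv∘f bg i))

  inv-invertible : {f : Fin n → Fin n} (bf : Invertible f) → Invertible (inv bf)
  inv-invertible {f} bf = invertible f (inv∘f bf) (f∘inv bf)

  invertible⇒injective : {f : Fin n → Fin n} → Invertible f → Injective _≡_ _≡_ f
  invertible⇒injective bf {i} {j} e = trans (sym (inv∘f bf i)) (trans (cong (inv bf) e) (inv∘f bf j))

  injective⇒invertible : {f : Fin n → Fin n} → Injective _≡_ _≡_ f → Invertible f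
  injective⇒invertible {f} inj = invertible
    (λ y → proj₁ (injective⇒surjective f inj y))
    (λ y → proj₂ (injective⇒surjective f inj y))
    (λ i → inj (proj₂ (injective⇒surjective f inj (f i))))

  record InSym (X : List (Fin n)) (f : Fin n → Fin n) : Set where
    constructor inSym
    field
      injective : Injective _≡_ _≡_ f
      fixed     : ∀ i → i ∉ X → f i ≡ i
  open InSym public

  inSymB : List (Fin n) → (Fin n → Fin n) → Bool
  inSymB X f = injB f ∧ allB (λ i → memB i X ∨ (f i == i))

  inSymB⇒InSym : ∀ X f → inSymB X f ≡ true → InSym X f
  inSymB⇒InSym X f e = inSym (injB⇒injective f (proj₁ (∧-true e))) fixes
    where
    fixes : ∀ i → i ∉ X → f i ≡ i
    fixes i i∉X with ∨-true {memB i X} (allB⇒∀ _ (proj₂ (∧-true {injB f} e)) i)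
    ... | inj₁ i∈X  = ⊥-elim (i∉X (memB⇒∈ i X i∈X))
    ... | inj₂ fi≡i = ==⇒≡ fi≡i

  InSym⇒inSymB : ∀ X f → InSym X f → inSymB X f ≡ true
  InSym⇒inSymB X f (inSym inj fixes) = true-∧ (injective⇒injB f inj) (∀⇒allB _ at)
    where
    at : ∀ i → (memB i X ∨ (f i == i)) ≡ true
    at i with i ∈? X
    ... | yes i∈X = true-∨ˡ (∈⇒memB i X i∈X)
    ... | no i∉X  = true-∨ʳ {memB i X} (≡⇒== (fixes i i∉X))

  ¬InSym⇒inSymB : ∀ X f → ¬ InSym X f → inSymB X f ≡ false
  ¬InSym⇒inSymB X f ¬f∈ with inSymB X f in e
  ... | true  = ⊥-elim (¬f∈ (inSymB⇒InSym X f e))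
  ... | false = refl

  InSym? : ∀ X f → Dec (InSym X f)
  InSym? X f with inSymB X f in e
  ... | true  = yes (inSymB⇒InSym X f e)
  ... | false = no (λ f∈ → case trans (sym e) (InSym⇒inSymB X f f∈) of λ ())

  InSym-cong : ∀ {X f g} → f ≗ g → InSym X f → InSym X g
  InSym-cong f≗g (inSym inj fixes) =
    inSym (λ e → inj (trans (f≗g _) (trans e (sym (f≗g _))))) (λ i i∉X → trans (sym (f≗g i)) (fixes i i∉X))

  inSymB-cong : ∀ X {f g} → f ≗ g → inSymB X f ≡ inSymB X g
  inSymB-cong X f≗g = bool-ext
    (λ e → InSym⇒inSymB X _ (InSym-cong f≗g (inSymB⇒InSym X _ e)))
    (λ e → InSym⇒inSymB X _ (InSym-cong (sym ∘ f≗g) (inSymB⇒InSym X _ e)))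

  InSym-id : ∀ {X} → InSym X id
  InSym-id = inSym id (λ _ _ → refl)

  InSym-∘ : ∀ {X f g} → InSym X f → InSym X g → InSym X (f ∘ g)
  InSym-∘ {f = f} (inSym f-inj f-fix) (inSym g-inj g-fix) =
    inSym (g-inj ∘ f-inj) (λ i i∉X → trans (cong f (g-fix i i∉X)) (f-fix i i∉X))

  InSym-⊆ : ∀ {X Y f} → (∀ {x} → x ∈ X → x ∈ Y) → InSym X f → InSym Y f
  InSym-⊆ X⊆Y (inSym inj fixes) = inSym inj (λ x x∉Y → fixes x (x∉Y ∘ X⊆Y))

  InSym⇒invertible : ∀ {X f} → InSym X f → Invertible f
  InSym⇒invertible = injective⇒invertible ∘ injective

  InSym-inv : ∀ {X f} (f∈ : InSym X f) → InSym X (inv (InSym⇒invertible f∈))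
  InSym-inv f∈ = inSym (invertible⇒injective (inv-invertible bf))
    (λ i i∉X → trans (cong (inv bf) (sym (fixed f∈ i i∉X))) (inv∘f bf i))
    where bf = InSym⇒invertible f∈

  InSym-stable : ∀ {X f} → InSym X f → ∀ {x} → x ∈ X → f x ∈ X
  InSym-stable {X} {f} f∈ {x} x∈X with f x ∈? X
  ... | yes fx∈X = fx∈X
  ... | no fx∉X  = ⊥-elim (fx∉X (subst (_∈ X) (sym (injective f∈ (fixed f∈ (f x) fx∉X))) x∈X))

  InSym-commute : ∀ {X ρ h} → InSym X ρ → Injective _≡_ _≡_ h → (∀ x → x ∈ X → h x ≡ x) → ∀ i → ρ (h i) ≡ h (ρ i)
  InSym-commute {X} {ρ} {h} ρ∈ h-inj h-fixes i with i ∈? X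
  ... | yes i∈X = trans (cong ρ (h-fixes i i∈X)) (sym (h-fixes (ρ i) (InSym-stable ρ∈ i∈X)))
  ... | no i∉X  = trans (fixed ρ∈ (h i) hi∉X) (cong h (sym (fixed ρ∈ i i∉X)))
    where
    hi∉X : h i ∉ X
    hi∉X hi∈X = i∉X (subst (_∈ X) (h-inj (h-fixes (h i) hi∈X)) hi∈X)

module ListSum {c ℓ} (M : CommutativeMonoid c ℓ) where
  open CommutativeMonoid M renaming (Carrier to M₀; refl to ≈-refl; sym to ≈-sym; trans to ≈-trans)
  open import Relation.Binary.Reasoning.Setoid setoid
  open import Algebra.Properties.CommutativeSemigroup commutativeSemigroup using (interchange)

  ∑ : List A → (A → M₀) → M₀
  ∑ []       w = ε
  ∑ (x ∷ xs) w = w x ∙ ∑ xs w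

  ∑-cong≡ : (xs : List A) {w w′ : A → M₀} → (∀ x → w x ≡ w′ x) → ∑ xs w ≡ ∑ xs w′
  ∑-cong≡ []       _ = refl
  ∑-cong≡ (x ∷ xs) e = cong₂ _∙_ (e x) (∑-cong≡ xs e)

  ∑-cong : (xs : List A) {w w′ : A → M₀} → (∀ x → w x ≈ w′ x) → ∑ xs w ≈ ∑ xs w′
  ∑-cong []       _ = ≈-refl
  ∑-cong (x ∷ xs) e = ∙-cong (e x) (∑-cong xs e)

  ∑-congᴬ : (xs : List A) {w w′ : A → M₀} → All (λ x → w x ≈ w′ x) xs → ∑ xs w ≈ ∑ xs w′
  ∑-congᴬ []       []       = ≈-refl
  ∑-congᴬ (x ∷ xs) (e ∷ es) = ∙-cong e (∑-congᴬ xs es)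

  ∑-ε : (xs : List A) → ∑ xs (λ _ → ε) ≈ ε
  ∑-ε []       = ≈-refl
  ∑-ε (x ∷ xs) = ≈-trans (identityˡ _) (∑-ε xs)

  ∑-vanishes : (xs : List A) {w : A → M₀} → All (λ x → w x ≈ ε) xs → ∑ xs w ≈ ε
  ∑-vanishes xs w≈ε = ≈-trans (∑-congᴬ xs w≈ε) (∑-ε xs)

  ∑-++ : (xs ys : List A) (w : A → M₀) → ∑ (xs ++ ys) w ≈ ∑ xs w ∙ ∑ ys w
  ∑-++ []       ys w = ≈-sym (identityˡ _)
  ∑-++ (x ∷ xs) ys w = ≈-trans (∙-congˡ (∑-++ xs ys w)) (≈-sym (assoc _ _ _))

  ∑-∙ : (xs : List A) (w w′ : A → M₀) → ∑ xs (λ x → w x ∙ w′ x) ≈ ∑ xs w ∙ ∑ xs w′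
  ∑-∙ []       w w′ = ≈-sym (identityˡ _)
  ∑-∙ (x ∷ xs) w w′ = ≈-trans (∙-congˡ (∑-∙ xs w w′)) (interchange _ _ _ _)

  ∑-map : ∀ {b} {B : Set b} (h : A → B) (xs : List A) (w : B → M₀) → ∑ (map h xs) w ≡ ∑ xs (w ∘ h)
  ∑-map h []       w = refl
  ∑-map h (x ∷ xs) w = cong (w (h x) ∙_) (∑-map h xs w)

  ∑-concatMap : ∀ {b} {B : Set b} (h : A → List B) (xs : List A) (w : B → M₀) →
                ∑ (concatMap h xs) w ≈ ∑ xs (λ x → ∑ (h x) w)
  ∑-concatMap h []       w = ≈-refl
  ∑-concatMap h (x ∷ xs) w = ≈-trans (∑-++ (h x) (concatMap h xs) w) (∙-congˡ (∑-concatMap h xs w))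

  ∑-swap : ∀ {b} {B : Set b} (xs : List A) (ys : List B) (w : A → B → M₀) →
           ∑ xs (λ x → ∑ ys (w x)) ≈ ∑ ys (λ y → ∑ xs (λ x → w x y))
  ∑-swap []       ys w = ≈-sym (∑-ε ys)
  ∑-swap (x ∷ xs) ys w = ≈-trans (∙-congˡ (∑-swap xs ys w)) (≈-sym (∑-∙ ys (w x) _))

  ∑-single-support : (xs : List A) → Unique xs → ∀ {x₀} → x₀ ∈ xs → (w : A → M₀) →
                     (∀ x → x ∈ xs → x ≢ x₀ → w x ≈ ε) → ∑ xs w ≈ w x₀
  ∑-single-support (x ∷ xs) (x≢xs ∷ _) (here refl) w w≈ε = ≈-trans
    (∙-congˡ (∑-vanishes xs (All.tabulate (λ {x′} x′∈xs → w≈ε x′ (there x′∈xs) (All.lookup x≢xs x′∈xs ∘ sym)))))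
    (identityʳ _)
  ∑-single-support (x ∷ xs) (x≢xs ∷ xs-unique) (there x₀∈xs) w w≈ε = ≈-trans
    (∙-cong (w≈ε x (here refl) (All.lookup x≢xs x₀∈xs)) (∑-single-support xs xs-unique x₀∈xs w (λ x′ → w≈ε x′ ∘ there)))
    (identityˡ _)

  ∑-allFin-suc : ∀ {m} (w : Fin (suc m) → M₀) → ∑ (allFin (suc m)) w ≡ w zero ∙ ∑ (allFin m) (w ∘ suc)
  ∑-allFin-suc {m} w = cong (w zero ∙_) (trans (cong (λ l → ∑ l w) (sym (map-tabulate id suc))) (∑-map suc (allFin m) w))

  ∑-δ : ∀ {m} (c : Fin m) (v : Fin m → M₀) → ∑ (allFin m) (λ k → if k == c then v k else ε) ≈ v c
  ∑-δ {suc m} zero v = begin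
    ∑ (allFin (suc m)) (λ k → if k == zero then v k else ε) ≡⟨ ∑-allFin-suc (λ k → if k == zero then v k else ε) ⟩
    v zero ∙ ∑ (allFin m) (λ _ → ε)                          ≈⟨ ∙-congˡ (∑-ε (allFin m)) ⟩
    v zero ∙ ε                                               ≈⟨ identityʳ _ ⟩
    v zero                                                   ∎
  ∑-δ {suc m} (suc c) v = begin
    ∑ (allFin (suc m)) (λ k → if k == suc c then v k else ε) ≡⟨ ∑-allFin-suc (λ k → if k == suc c then v k else ε) ⟩
    ε ∙ ∑ (allFin m) (λ k → if k == c then v (suc k) else ε) ≈⟨ identityˡ _ ⟩
    ∑ (allFin m) (λ k → if k == c then v (suc k) else ε)     ≈⟨ ∑-δ c (v ∘ suc) ⟩
    v (suc c)                                                ∎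

  ∑-reindex : ∀ {m} (s : Fin m → Fin m) → (∀ i → s (s i) ≡ i) → (w : Fin m → M₀) →
              ∑ (allFin m) (w ∘ s) ≈ ∑ (allFin m) w
  ∑-reindex {m} s s-invol w = begin
    ∑ (allFin m) (w ∘ s)                                                        ≈⟨ ∑-cong (allFin m) (λ i → ≈-sym (∑-δ (s i) w)) ⟩
    ∑ (allFin m) (λ i → ∑ (allFin m) (λ k → if k == s i then w k else ε))     ≈⟨ ∑-swap (allFin m) (allFin m) _ ⟩
    ∑ (allFin m) (λ k → ∑ (allFin m) (λ i → if k == s i then w k else ε))     ≈⟨ ∑-cong (allFin m) (λ k → ∑-cong (allFin m) (λ i →
                                                                                     reflexive (cong (λ b → if b then w k else ε) (k↔i k i)))) ⟩
    ∑ (allFin m) (λ k → ∑ (allFin m) (λ i → if i == s k then w k else ε))     ≈⟨ ∑-cong (allFin m) (λ k → ∑-δ (s k) (λ _ → w k)) ⟩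
    ∑ (allFin m) w                                                              ∎
    where
    k↔i : ∀ k i → (k == s i) ≡ (i == s k)
    k↔i k i = bool-ext (λ e → ≡⇒== (trans (sym (s-invol i)) (cong s (sym (==⇒≡ e)))))
                       (λ e → ≡⇒== (trans (sym (s-invol k)) (cong s (sym (==⇒≡ e)))))

module _ {n : ℕ} where

  transp-≡ˡ : (x y : Fin n) → transp x y x ≡ y
  transp-≡ˡ x y rewrite ==-refl x = refl

  transp-≡ʳ : (x y : Fin n) → x ≢ y → transp x y y ≡ x
  transp-≡ʳ x y x≢y rewrite ≢⇒==false (x≢y ∘ sym) | ==-refl y = refl

  transp-≢ : (x y i : Fin n) → i ≢ x → i ≢ y → transp x y i ≡ i
  transp-≢ x y i i≢x i≢y rewrite ≢⇒==false i≢x | ≢⇒==false i≢y = refl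

  data TranspCase (x y i : Fin n) : Set where
    at-x      : i ≡ x → TranspCase x y i
    at-y      : i ≡ y → i ≢ x → TranspCase x y i
    elsewhere : i ≢ x → i ≢ y → TranspCase x y i

  transpCase : ∀ x y i → TranspCase x y i
  transpCase x y i with i ≟F x | i ≟F y
  ... | yes i≡x | _       = at-x i≡x
  ... | no i≢x  | yes i≡y = at-y i≡y i≢x
  ... | no i≢x  | no i≢y  = elsewhere i≢x i≢y

  transp-comm : (x y : Fin n) → transp x y ≗ transp y x
  transp-comm x y i with x ≟F y
  ... | yes refl = refl
  ... | no x≢y with transpCase x y i
  ... | at-x refl          = trans (transp-≡ˡ i y) (sym (transp-≡ʳ y i (x≢y ∘ sym)))
  ... | at-y refl _        = trans (transp-≡ʳ x i x≢y) (sym (transp-≡ˡ i x))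
  ... | elsewhere i≢x i≢y  = trans (transp-≢ x y i i≢x i≢y) (sym (transp-≢ y x i i≢y i≢x))

  transp-involutive : (x y : Fin n) → ∀ i → transp x y (transp x y i) ≡ i
  transp-involutive x y i with x ≟F y
  ... | yes refl with transpCase x x i
  ...   | elsewhere i≢x _  = trans (cong (transp x x) (transp-≢ x x i i≢x i≢x)) (transp-≢ x x i i≢x i≢x)
  ...   | at-x refl        = trans (cong (transp i i) (transp-≡ˡ i i)) (transp-≡ˡ i i)
  ...   | at-y refl _      = trans (cong (transp i i) (transp-≡ˡ i i)) (transp-≡ˡ i i)
  transp-involutive x y i | no x≢y with transpCase x y i
  ...   | at-x refl        = trans (cong (transp i y) (transp-≡ˡ i y)) (transp-≡ʳ i y x≢y)
  ...   | at-y refl _      = trans (cong (transp x i) (transp-≡ʳ x i x≢y)) (transp-≡ˡ x i)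
  ...   | elsewhere i≢x i≢y = trans (cong (transp x y) (transp-≢ x y i i≢x i≢y)) (transp-≢ x y i i≢x i≢y)

  transp-invertible : (x y : Fin n) → Invertible (transp x y)
  transp-invertible x y = invertible (transp x y) (transp-involutive x y) (transp-involutive x y)

  transp-injective : (x y : Fin n) → Injective _≡_ _≡_ (transp x y)
  transp-injective x y = invertible⇒injective (transp-invertible x y)

  transp-InSym : ∀ {X} {x y : Fin n} → x ∈ X → y ∈ X → InSym X (transp x y)
  transp-InSym {X} {x} {y} x∈X y∈X = inSym (transp-injective x y)
    (λ i i∉X → transp-≢ x y i (λ i≡x → i∉X (subst (_∈ X) (sym i≡x) x∈X)) (λ i≡y → i∉X (subst (_∈ X) (sym i≡y) y∈X)))

  transp-conj : (g : Fin n → Fin n) → Injective _≡_ _≡_ g → ∀ x y i → transp (g x) (g y) (g i) ≡ g (transp x y i)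
  transp-conj g g-inj x y i with x ≟F y | transpCase x y i
  ... | _        | at-x refl   = trans (transp-≡ˡ (g i) (g y)) (cong g (sym (transp-≡ˡ i y)))
  ... | yes refl | at-y refl _ = trans (transp-≡ˡ (g i) (g i)) (cong g (sym (transp-≡ˡ i i)))
  ... | no x≢y   | at-y refl _ = trans (transp-≡ʳ (g x) (g i) (x≢y ∘ g-inj)) (cong g (sym (transp-≡ʳ x i x≢y)))
  ... | _        | elsewhere i≢x i≢y =
    trans (transp-≢ (g x) (g y) (g i) (i≢x ∘ g-inj) (i≢y ∘ g-inj)) (cong g (sym (transp-≢ x y i i≢x i≢y)))

  transp-∘ : (g : Fin n → Fin n) (bg : Invertible g) (x y : Fin n) → (transp x y ∘ g) ≗ (g ∘ transp (inv bg x) (inv bg y))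
  transp-∘ g bg x y i = trans (cong₂ (λ u v → transp u v (g i)) (sym (f∘inv bg x)) (sym (f∘inv bg y)))
                              (transp-conj g (invertible⇒injective bg) (inv bg x) (inv bg y) i)

  transp-via : (x x′ y : Fin n) → x ≢ x′ → x ≢ y → x′ ≢ y → transp x y ≗ (transp x′ y ∘ transp x x′ ∘ transp x′ y)
  transp-via x x′ y x≢x′ x≢y x′≢y i = by-cases (i ≟F x) (i ≟F y) (i ≟F x′)
    where
    by-cases : Dec (i ≡ x) → Dec (i ≡ y) → Dec (i ≡ x′) → transp x y i ≡ transp x′ y (transp x x′ (transp x′ y i))
    by-cases (yes refl) _ _
      rewrite transp-≢ x′ y i x≢x′ x≢y | transp-≡ˡ i x′ | transp-≡ˡ x′ y = transp-≡ˡ i y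
    by-cases (no _) (yes refl) _
      rewrite transp-≡ʳ x′ i x′≢y | transp-≡ʳ x x′ x≢x′ | transp-≢ x′ i x x≢x′ x≢y = transp-≡ʳ x i x≢y
    by-cases (no i≢x) (no i≢y) (yes refl)
      rewrite transp-≡ˡ i y | transp-≢ x i y (x≢y ∘ sym) (x′≢y ∘ sym) | transp-≡ʳ i y x′≢y = transp-≢ x y i i≢x i≢y
    by-cases (no i≢x) (no i≢y) (no i≢x′)
      rewrite transp-≢ x′ y i i≢x′ i≢y | transp-≢ x x′ i i≢x i≢x′ | transp-≢ x′ y i i≢x′ i≢y = transp-≢ x y i i≢x i≢y

-- A transposition changes the parity of the number of inversions

module Parity where
  open import Data.Nat using (_+_)
  open ListSum ℕₚ.+-0-commutativeMonoid

  module _ {n : ℕ} where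

    _<ᵇ_ : Fin n → Fin n → Bool
    i <ᵇ j = does (i F.<? j)

    <ᵇ⇒< : {i j : Fin n} → (i <ᵇ j) ≡ true → toℕ i < toℕ j
    <ᵇ⇒< {i} {j} e = ℕₚ.<ᵇ⇒< (toℕ i) (toℕ j) (Equivalence.from T-≡ e)

    <⇒<ᵇ : {i j : Fin n} → toℕ i < toℕ j → (i <ᵇ j) ≡ true
    <⇒<ᵇ i<j = Equivalence.to T-≡ (ℕₚ.<⇒<ᵇ i<j)

    ≮⇒<ᵇ≡false : {i j : Fin n} → ¬ (toℕ i < toℕ j) → (i <ᵇ j) ≡ false
    ≮⇒<ᵇ≡false {i} {j} i≮j with i <ᵇ j in e
    ... | true  = ⊥-elim (i≮j (<ᵇ⇒< e))
    ... | false = refl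

    <ᵇ≡false⇒≮ : {i j : Fin n} → (i <ᵇ j) ≡ false → ¬ (toℕ i < toℕ j)
    <ᵇ≡false⇒≮ e i<j with () ← trans (sym e) (<⇒<ᵇ i<j)

    <ᵇ-irrefl : (i : Fin n) → (i <ᵇ i) ≡ false
    <ᵇ-irrefl i = ≮⇒<ᵇ≡false {i = i} {j = i} (ℕₚ.<-irrefl refl)

    <ᵇ-cong : {i j k l : Fin n} → (toℕ i < toℕ j → toℕ k < toℕ l) → (toℕ k < toℕ l → toℕ i < toℕ j) → (i <ᵇ j) ≡ (k <ᵇ l)
    <ᵇ-cong ⇒ ⇐ = bool-ext (λ e → <⇒<ᵇ (⇒ (<ᵇ⇒< e))) (λ e → <⇒<ᵇ (⇐ (<ᵇ⇒< e)))

    inversion : (Fin n → Fin n) → Fin n → Fin n → ℕ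
    inversion f i j = if i <ᵇ j ∧ f j <ᵇ f i then 1 else 0

    ∑∑ : (Fin n → Fin n → ℕ) → ℕ
    ∑∑ w = ∑ (allFin n) (λ i → ∑ (allFin n) (w i))

    ∑∑-+ : (w w′ : Fin n → Fin n → ℕ) → ∑∑ (λ i j → w i j + w′ i j) ≡ ∑∑ w + ∑∑ w′
    ∑∑-+ w w′ = trans (∑-cong (allFin n) (λ i → ∑-∙ (allFin n) (w i) (w′ i))) (∑-∙ (allFin n) _ _)

    ∑∑-cong : {w w′ : Fin n → Fin n → ℕ} → (∀ i j → w i j ≡ w′ i j) → ∑∑ w ≡ ∑∑ w′
    ∑∑-cong w≡w′ = ∑-cong (allFin n) (λ i → ∑-cong (allFin n) (w≡w′ i))

    ∑∑-at : (x y : Fin n) (v : ℕ) → ∑∑ (λ i j → if (i == x) ∧ (j == y) then v else 0) ≡ v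
    ∑∑-at x y v = trans (∑-cong (allFin n) row) (∑-δ x (λ _ → v))
      where
      row : ∀ i → ∑ (allFin n) (λ j → if (i == x) ∧ (j == y) then v else 0) ≡ (if i == x then v else 0)
      row i with i == x
      ... | true  = ∑-δ y (λ _ → v)
      ... | false = ∑-ε (allFin n)

    sumℕ-map : ∀ {a} {A : Set a} (xs : List A) (w : A → ℕ) → sumℕ (map w xs) ≡ ∑ xs w
    sumℕ-map []       w = refl
    sumℕ-map (x ∷ xs) w = cong (w x +_) (sumℕ-map xs w)

    inversions≡∑∑ : (f : Fin n → Fin n) → inversions f ≡ ∑∑ (inversion f)
    inversions≡∑∑ f = trans (cong sumℕ (map-cong (λ i → sumℕ-map (allFin n) (inversion f i)) (allFin n)))
                            (sumℕ-map (allFin n) _)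

    inversions-cong : {f g : Fin n → Fin n} → f ≗ g → inversions f ≡ inversions g
    inversions-cong {f} {g} f≗g = begin
      inversions f        ≡⟨ inversions≡∑∑ f ⟩
      ∑∑ (inversion f)    ≡⟨ ∑∑-cong (λ i j → cong₂ (λ u v → if i <ᵇ j ∧ u <ᵇ v then 1 else 0) (f≗g j) (f≗g i)) ⟩
      ∑∑ (inversion g)    ≡⟨ inversions≡∑∑ g ⟨
      inversions g        ∎
      where open ≡-Reasoning

  module Adjacent {n : ℕ} (x y : Fin n) (y≡x+1 : toℕ y ≡ suc (toℕ x)) where

    private
      s : Fin n → Fin n
      s = transp x y

    x≢y : x ≢ y
    x≢y x≡y = ℕₚ.<-irrefl (trans (cong toℕ x≡y) y≡x+1) (ℕₚ.n<1+n (toℕ x))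

    x<ᵇy : (x <ᵇ y) ≡ true
    x<ᵇy = <⇒<ᵇ (subst (toℕ x <_) (sym y≡x+1) (ℕₚ.n<1+n _))

    y<ᵇx : (y <ᵇ x) ≡ false
    y<ᵇx = ≮⇒<ᵇ≡false {i = y} {j = x} (λ y<x → ℕₚ.<-asym y<x (<ᵇ⇒< {i = x} {j = y} x<ᵇy))

    -- no third point lies strictly between x and y
    x<ᵇ≡y<ᵇ : ∀ k → k ≢ x → k ≢ y → (x <ᵇ k) ≡ (y <ᵇ k)
    x<ᵇ≡y<ᵇ k k≢x k≢y = <ᵇ-cong
      (λ x<k → subst (_< toℕ k) (sym y≡x+1) (ℕₚ.≤∧≢⇒< x<k (λ e → k≢y (toℕ-injective (trans (sym e) (sym y≡x+1))))))
      (ℕₚ.<-trans (subst (toℕ x <_) (sym y≡x+1) (ℕₚ.n<1+n _)))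

    <ᵇx≡<ᵇy : ∀ k → k ≢ x → k ≢ y → (k <ᵇ x) ≡ (k <ᵇ y)
    <ᵇx≡<ᵇy k k≢x k≢y = <ᵇ-cong
      (λ k<x → subst (toℕ k <_) (sym y≡x+1) (ℕₚ.m<n⇒m<1+n k<x))
      (λ k<y → ℕₚ.≤∧≢⇒< (ℕ.s≤s⁻¹ (subst (toℕ k <_) y≡x+1 k<y)) (k≢x ∘ toℕ-injective))

    transp-<ᵇ : ∀ i j → ¬ (i ≡ x × j ≡ y) → ¬ (i ≡ y × j ≡ x) → (s i <ᵇ s j) ≡ (i <ᵇ j)
    transp-<ᵇ i j ¬xy ¬yx with transpCase x y i | transpCase x y j
    ... | at-x refl     | at-x refl     = trans (<ᵇ-irrefl (s i)) (sym (<ᵇ-irrefl i))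
    ... | at-x refl     | at-y refl _   = ⊥-elim (¬xy (refl , refl))
    ... | at-x refl     | elsewhere p q rewrite transp-≡ˡ i y | transp-≢ i y j p q = sym (x<ᵇ≡y<ᵇ j p q)
    ... | at-y refl _   | at-x refl     = ⊥-elim (¬yx (refl , refl))
    ... | at-y refl _   | at-y refl _   = trans (<ᵇ-irrefl (s i)) (sym (<ᵇ-irrefl i))
    ... | at-y refl _   | elsewhere p q rewrite transp-≡ʳ x i x≢y | transp-≢ x i j p q = x<ᵇ≡y<ᵇ j p q
    ... | elsewhere p q | at-x refl     rewrite transp-≢ j y i p q | transp-≡ˡ j y = sym (<ᵇx≡<ᵇy i p q)
    ... | elsewhere p q | at-y refl _   rewrite transp-≢ x j i p q | transp-≡ʳ x j x≢y = <ᵇx≡<ᵇy i p q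
    ... | elsewhere p q | elsewhere p′ q′ rewrite transp-≢ x y i p q | transp-≢ x y j p′ q′ = refl

    module _ (g : Fin n → Fin n) (g-inj : Injective _≡_ _≡_ g) where

      private
        inversionˢ : Fin n → Fin n → ℕ
        inversionˢ i j = if s i <ᵇ s j ∧ g j <ᵇ g i then 1 else 0

        α β : ℕ
        α = if g y <ᵇ g x then 1 else 0
        β = if g x <ᵇ g y then 1 else 0

      inversions-∘-transp : inversions (g ∘ s) ≡ ∑∑ inversionˢ
      inversions-∘-transp = begin
        inversions (g ∘ s)                                                             ≡⟨ inversions≡∑∑ (g ∘ s) ⟩
        ∑∑ (λ i j → if i <ᵇ j ∧ g (s j) <ᵇ g (s i) then 1 else 0)                     ≡⟨ ∑-reindex s (transp-involutive x y) _ ⟨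
        ∑∑ (λ i j → if s i <ᵇ j ∧ g (s j) <ᵇ g (s (s i)) then 1 else 0)               ≡⟨ ∑∑-cong (λ i j →
                                       cong (λ k → if s i <ᵇ j ∧ g (s j) <ᵇ g k then 1 else 0) (transp-involutive x y i)) ⟩
        ∑∑ (λ i j → if s i <ᵇ j ∧ g (s j) <ᵇ g i then 1 else 0)                       ≡⟨ ∑-cong (allFin n) (λ i →
                                       sym (∑-reindex s (transp-involutive x y) (λ j → if s i <ᵇ j ∧ g (s j) <ᵇ g i then 1 else 0))) ⟩
        ∑∑ (λ i j → if s i <ᵇ s j ∧ g (s (s j)) <ᵇ g i then 1 else 0)                 ≡⟨ ∑∑-cong (λ i j →
                                       cong (λ k → if s i <ᵇ s j ∧ g k <ᵇ g i then 1 else 0) (transp-involutive x y j)) ⟩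
        ∑∑ inversionˢ                                                                  ∎
        where open ≡-Reasoning

      -- inversionˢ and inversion g differ only at (x , y) and (y , x)
      inversionˢ-corrected : ∀ i j → inversionˢ i j + (if (i == x) ∧ (j == y) then α else 0)
                                   ≡ inversion g i j + (if (i == y) ∧ (j == x) then β else 0)
      inversionˢ-corrected i j with transpCase x y i | transpCase x y j
      ... | at-x refl | at-x refl
        rewrite <ᵇ-irrefl (s i) | <ᵇ-irrefl i | ==-refl i | ≢⇒==false x≢y = refl
      ... | at-x refl | at-y refl _
        rewrite transp-≡ˡ i j | transp-≡ʳ i j x≢y | y<ᵇx | x<ᵇy | ==-refl i | ==-refl j | ≢⇒==false x≢y = ℕₚ.+-comm 0 α
      ... | at-x refl | elsewhere p q
        rewrite transp-<ᵇ i j (λ (_ , e) → q e) (λ (e , _) → x≢y e) | ==-refl i | ≢⇒==false q | ≢⇒==false x≢y = refl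
      ... | at-y refl i≢x | at-x refl
        rewrite transp-≡ˡ j i | transp-≡ʳ j i x≢y | y<ᵇx | x<ᵇy | ==-refl i | ==-refl j | ≢⇒==false i≢x = ℕₚ.+-comm β 0
      ... | at-y refl i≢x | at-y refl _
        rewrite <ᵇ-irrefl (s i) | <ᵇ-irrefl i | ≢⇒==false i≢x | ==-refl i = refl
      ... | at-y refl i≢x | elsewhere p q
        rewrite transp-<ᵇ i j (λ (e , _) → i≢x e) (λ (_ , e) → p e) | ≢⇒==false i≢x | ==-refl i | ≢⇒==false p = refl
      ... | elsewhere p q | _
        rewrite transp-<ᵇ i j (λ (e , _) → p e) (λ (e , _) → q e) | ≢⇒==false p | ≢⇒==false q = refl

      inversions-∘-transp-corrected : inversions (g ∘ s) + α ≡ inversions g + β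
      inversions-∘-transp-corrected = begin
        inversions (g ∘ s) + α                                           ≡⟨ cong₂ _+_ inversions-∘-transp (sym (∑∑-at x y α)) ⟩
        ∑∑ inversionˢ + ∑∑ (λ i j → if (i == x) ∧ (j == y) then α else 0) ≡⟨ ∑∑-+ inversionˢ _ ⟨
        ∑∑ (λ i j → inversionˢ i j + (if (i == x) ∧ (j == y) then α else 0)) ≡⟨ ∑∑-cong inversionˢ-corrected ⟩
        ∑∑ (λ i j → inversion g i j + (if (i == y) ∧ (j == x) then β else 0)) ≡⟨ ∑∑-+ (inversion g) _ ⟩
        ∑∑ (inversion g) + ∑∑ (λ i j → if (i == y) ∧ (j == x) then β else 0) ≡⟨ cong₂ _+_ (sym (inversions≡∑∑ g)) (∑∑-at y x β) ⟩
        inversions g + β                                                 ∎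
        where open ≡-Reasoning

      even-+1 : ∀ k → even (k + 1) ≡ not (even k)
      even-+1 k = cong even (ℕₚ.+-comm k 1)

      parity : even (inversions (g ∘ s)) ≡ not (even (inversions g))
      parity with g y <ᵇ g x in e₁ | g x <ᵇ g y in e₂ | inversions-∘-transp-corrected
      ... | true  | true  | _ = ⊥-elim (ℕₚ.<-asym (<ᵇ⇒< {i = g y} {j = g x} e₁) (<ᵇ⇒< {i = g x} {j = g y} e₂))
      ... | false | false | _ = ⊥-elim (x≢y (g-inj (toℕ-injective
                                  (ℕₚ.≤-antisym (ℕₚ.≮⇒≥ (<ᵇ≡false⇒≮ {i = g y} {j = g x} e₁)) (ℕₚ.≮⇒≥ (<ᵇ≡false⇒≮ {i = g x} {j = g y} e₂))))))
      ... | true  | false | eq = begin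
        even (inversions (g ∘ s))              ≡⟨ not-involutive (even (inversions (g ∘ s))) ⟨
        not (not (even (inversions (g ∘ s))))  ≡⟨ cong not (even-+1 (inversions (g ∘ s))) ⟨
        not (even (inversions (g ∘ s) + 1))    ≡⟨ cong (not ∘ even) (trans eq (ℕₚ.+-identityʳ _)) ⟩
        not (even (inversions g))              ∎
        where open ≡-Reasoning
      ... | false | true  | eq = begin
        even (inversions (g ∘ s))              ≡⟨ cong even (ℕₚ.+-identityʳ (inversions (g ∘ s))) ⟨
        even (inversions (g ∘ s) + 0)          ≡⟨ cong even eq ⟩
        even (inversions g + 1)                ≡⟨ even-+1 (inversions g) ⟩
        not (even (inversions g))              ∎
        where open ≡-Reasoning

  -- Induction on the distance d between x and y, conjugating by the adjacent transposition (x x+1).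
  parity-∘-transp-at-distance : ∀ d {n} (g : Fin n → Fin n) → Injective _≡_ _≡_ g → (x y : Fin n) →
    toℕ y ≡ suc (toℕ x + d) → even (inversions (g ∘ transp x y)) ≡ not (even (inversions g))
  parity-∘-transp-at-distance zero g g-inj x y y≡x+1 =
    Adjacent.parity x y (trans y≡x+1 (cong suc (ℕₚ.+-identityʳ _))) g g-inj
  parity-∘-transp-at-distance (suc d) {n} g g-inj x y y≡x+d+2 = begin
    even (inversions (g ∘ transp x y))                                  ≡⟨ cong even (inversions-cong (cong g ∘ transp-via x x′ y x≢x′ x≢y x′≢y)) ⟩
    even (inversions (((g ∘ transp x′ y) ∘ transp x x′) ∘ transp x′ y)) ≡⟨ parity-∘-transp-at-distance d _ g∘∘-inj x′ y y≡x′+d+1 ⟩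
    not (even (inversions ((g ∘ transp x′ y) ∘ transp x x′)))           ≡⟨ cong not (Adjacent.parity x x′ x′≡x+1 (g ∘ transp x′ y) g∘-inj) ⟩
    not (not (even (inversions (g ∘ transp x′ y))))                     ≡⟨ not-involutive _ ⟩
    even (inversions (g ∘ transp x′ y))                                 ≡⟨ parity-∘-transp-at-distance d g g-inj x′ y y≡x′+d+1 ⟩
    not (even (inversions g))                                           ∎
    where
    open ≡-Reasoning
    x+1<y : suc (toℕ x) < toℕ y
    x+1<y = subst (suc (toℕ x) <_) (sym y≡x+d+2) (s≤s (subst (suc (toℕ x) ≤_) (sym (ℕₚ.+-suc (toℕ x) d)) (s≤s (ℕₚ.m≤m+n (toℕ x) d))))
    x′ : Fin n
    x′ = F.fromℕ< (ℕₚ.<-trans x+1<y (toℕ<n y))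
    x′≡x+1 : toℕ x′ ≡ suc (toℕ x)
    x′≡x+1 = toℕ-fromℕ< _
    y≡x′+d+1 : toℕ y ≡ suc (toℕ x′ + d)
    y≡x′+d+1 = trans y≡x+d+2 (trans (cong suc (ℕₚ.+-suc (toℕ x) d)) (cong (λ k → suc (k + d)) (sym x′≡x+1)))
    x≢x′ : x ≢ x′
    x≢x′ e = ℕₚ.<-irrefl (trans (cong toℕ e) x′≡x+1) (ℕₚ.n<1+n _)
    x≢y : x ≢ y
    x≢y e = ℕₚ.<-irrefl (cong toℕ e) (ℕₚ.<-trans (ℕₚ.n<1+n _) x+1<y)
    x′≢y : x′ ≢ y
    x′≢y e = ℕₚ.<-irrefl (trans (sym x′≡x+1) (cong toℕ e)) x+1<y
    g∘-inj : Injective _≡_ _≡_ (g ∘ transp x′ y)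
    g∘-inj = transp-injective x′ y ∘ g-inj
    g∘∘-inj : Injective _≡_ _≡_ ((g ∘ transp x′ y) ∘ transp x x′)
    g∘∘-inj = transp-injective x x′ ∘ g∘-inj

  parity-∘-transp : ∀ {n} (g : Fin n → Fin n) → Injective _≡_ _≡_ g → (x y : Fin n) → x ≢ y →
    even (inversions (g ∘ transp x y)) ≡ not (even (inversions g))
  parity-∘-transp g g-inj x y x≢y with ℕₚ.<-cmp (toℕ x) (toℕ y)
  ... | tri< x<y _ _ = let (d , e) = ℕₚ.m≤n⇒∃[o]m+o≡n x<y in parity-∘-transp-at-distance d g g-inj x y (sym e)
  ... | tri≈ _ x≡y _ = ⊥-elim (x≢y (toℕ-injective x≡y))
  ... | tri> _ _ y<x = let (d , e) = ℕₚ.m≤n⇒∃[o]m+o≡n y<x in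
    trans (cong even (inversions-cong (cong g ∘ transp-comm x y))) (parity-∘-transp-at-distance d g g-inj y x (sym e))

  parity-transp-∘ : ∀ {n} (g : Fin n → Fin n) → Invertible g → (x y : Fin n) → x ≢ y →
    even (inversions (transp x y ∘ g)) ≡ not (even (inversions g))
  parity-transp-∘ g bg x y x≢y = trans (cong even (inversions-cong (transp-∘ g bg x y)))
    (parity-∘-transp g (invertible⇒injective bg) (inv bg x) (inv bg y)
      (λ e → x≢y (trans (sym (f∘inv bg x)) (trans (cong g e) (f∘inv bg y)))))

open Parity using (parity-∘-transp; parity-transp-∘)

module GroupAlgebraProperties {c ℓ} (K : CommutativeRing c ℓ) (n : ℕ) where
  open CommutativeRing K renaming (refl to ≈-refl; sym to ≈-sym; trans to ≈-trans) hiding (zero)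
  open GroupAlgebra K n
  open ListSum +-commutativeMonoid public
  open import Algebra.Properties.Ring ring using (-‿distribʳ-*; -0#≈0#; -‿involutive; -‿+-comm)
  open import Relation.Binary.Reasoning.Setoid setoid

  ∑-*ˡ : (xs : List A) (k : Carrier) (w : A → Carrier) → ∑ xs (λ x → k * w x) ≈ k * ∑ xs w
  ∑-*ˡ []       k w = ≈-sym (zeroʳ k)
  ∑-*ˡ (x ∷ xs) k w = ≈-trans (+-congˡ (∑-*ˡ xs k w)) (≈-sym (distribˡ k _ _))

  ∑-*ʳ : (xs : List A) (k : Carrier) (w : A → Carrier) → ∑ xs (λ x → w x * k) ≈ ∑ xs w * k
  ∑-*ʳ xs k w = ≈-trans (∑-cong xs (λ _ → *-comm _ _)) (≈-trans (∑-*ˡ xs k w) (*-comm _ _))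

  ∑-neg : (xs : List A) (w : A → Carrier) → ∑ xs (λ x → - w x) ≈ - ∑ xs w
  ∑-neg []       w = ≈-sym -0#≈0#
  ∑-neg (x ∷ xs) w = ≈-trans (+-congˡ (∑-neg xs w)) (-‿+-comm (w x) (∑ xs w))

  Term : Set c
  Term = Carrier × Perm

  AllPerms : ∀ {p} → (Perm → Set p) → GA → Set (c ⊔ p)
  AllPerms P = All (P ∘ proj₂)

  δ : Perm → Perm → Carrier → Carrier
  δ f g k = if eqMap f g then k else 0#

  termCoeff : Perm → Term → Carrier
  termCoeff g (k , f) = δ f g k

  coeff≡∑ : (x : GA) (g : Perm) → coeff x g ≡ ∑ x (termCoeff g)
  coeff≡∑ []            g = refl
  coeff≡∑ ((k , f) ∷ x) g = cong (δ f g k +_) (coeff≡∑ x g)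

  δ-cong : ∀ {f f′ g g′ k k′} → f ≗ f′ → g ≗ g′ → k ≈ k′ → δ f g k ≈ δ f′ g′ k′
  δ-cong {f} {f′} {g} {g′} f≗f′ g≗g′ k≈k′ with eqMap f g | eqMap f′ g′ | eqMap-cong f≗f′ g≗g′
  ... | true  | .true  | refl = k≈k′
  ... | false | .false | refl = ≈-refl

  δ-congᶜ : ∀ f g {k k′} → k ≈ k′ → δ f g k ≈ δ f g k′
  δ-congᶜ f g = δ-cong {f} (λ _ → refl) (λ _ → refl)

  δ-*ʳ : ∀ f g k k′ → δ f g (k * k′) ≈ δ f g k * k′
  δ-*ʳ f g k k′ with eqMap f g
  ... | true  = ≈-refl
  ... | false = ≈-sym (zeroˡ k′)

  δ-*ˡ : ∀ f g k k′ → δ f g (k * k′) ≈ k * δ f g k′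
  δ-*ˡ f g k k′ with eqMap f g
  ... | true  = ≈-refl
  ... | false = ≈-sym (zeroʳ k)

  δ-neg : ∀ f g k → δ f g (- k) ≈ - δ f g k
  δ-neg f g k with eqMap f g
  ... | true  = ≈-refl
  ... | false = ≈-sym -0#≈0#

  δ-∘ʳ : ∀ f g {h} (bh : Invertible h) k → δ (f ∘ h) g k ≡ δ f (g ∘ inv bh) k
  δ-∘ʳ f g {h} bh k = cong (λ b → if b then k else 0#) (bool-ext
    (λ e → ≗⇒eqMap (λ i → trans (cong f (sym (f∘inv bh i))) (eqMap⇒≗ {f = f ∘ h} {g = g} e (inv bh i))))
    (λ e → ≗⇒eqMap (λ i → trans (eqMap⇒≗ {f = f} {g = g ∘ inv bh} e (h i)) (cong g (inv∘f bh i)))))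

  δ-∘ˡ : ∀ h g {f} (bf : Invertible f) k → δ (f ∘ h) g k ≡ δ h (inv bf ∘ g) k
  δ-∘ˡ h g {f} bf k = cong (λ b → if b then k else 0#) (bool-ext
    (λ e → ≗⇒eqMap (λ i → trans (sym (inv∘f bf (h i))) (cong (inv bf) (eqMap⇒≗ {f = f ∘ h} {g = g} e i))))
    (λ e → ≗⇒eqMap (λ i → trans (cong f (eqMap⇒≗ {f = h} {g = inv bf ∘ g} e i)) (f∘inv bf (g i)))))

  infix 4 _≋_
  _≋_ : GA → GA → Set ℓ
  x ≋ y = ∀ g → coeff x g ≈ coeff y g

  ≋-setoid : Setoid c ℓ
  ≋-setoid = record
    { Carrier = GA ; _≈_ = _≋_
    ; isEquivalence = record { refl = λ _ → ≈-refl ; sym = λ e g → ≈-sym (e g) ; trans = λ e e′ g → ≈-trans (e g) (e′ g) } }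

  coeff-⊗ : ∀ x y g → coeff (x ⊗ y) g ≈ ∑ x (λ (k , f) → ∑ y (λ (k′ , f′) → δ (f ∘ f′) g (k * k′)))
  coeff-⊗ x y g rewrite coeff≡∑ (x ⊗ y) g =
    ≈-trans (∑-concatMap _ x (termCoeff g)) (∑-cong x (λ s → reflexive (∑-map _ y (termCoeff g))))

  ∑-δ-∘ʳ : ∀ z {h} (bh : Invertible h) k g → ∑ z (λ (k′ , f′) → δ (f′ ∘ h) g (k′ * k)) ≈ coeff z (g ∘ inv bh) * k
  ∑-δ-∘ʳ z {h} bh k g = begin
    ∑ z (λ (k′ , f′) → δ (f′ ∘ h) g (k′ * k))   ≈⟨ ∑-cong z (λ (k′ , f′) → δ-*ʳ (f′ ∘ h) g k′ k) ⟩
    ∑ z (λ (k′ , f′) → δ (f′ ∘ h) g k′ * k)     ≈⟨ ∑-*ʳ z k _ ⟩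
    ∑ z (λ (k′ , f′) → δ (f′ ∘ h) g k′) * k     ≡⟨ cong (_* k) (∑-cong≡ z (λ (k′ , f′) → δ-∘ʳ f′ g bh k′)) ⟩
    ∑ z (termCoeff (g ∘ inv bh)) * k            ≡⟨ cong (_* k) (coeff≡∑ z _) ⟨
    coeff z (g ∘ inv bh) * k                    ∎

  ∑-δ-∘ˡ : ∀ z {f} (bf : Invertible f) k g → ∑ z (λ (k′ , f′) → δ (f ∘ f′) g (k * k′)) ≈ k * coeff z (inv bf ∘ g)
  ∑-δ-∘ˡ z {f} bf k g = begin
    ∑ z (λ (k′ , f′) → δ (f ∘ f′) g (k * k′))   ≈⟨ ∑-cong z (λ (k′ , f′) → δ-*ˡ (f ∘ f′) g k k′) ⟩
    ∑ z (λ (k′ , f′) → k * δ (f ∘ f′) g k′)     ≈⟨ ∑-*ˡ z k _ ⟩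
    k * ∑ z (λ (k′ , f′) → δ (f ∘ f′) g k′)     ≡⟨ cong (k *_) (∑-cong≡ z (λ (k′ , f′) → δ-∘ˡ f′ g bf k′)) ⟩
    k * ∑ z (termCoeff (inv bf ∘ g))            ≡⟨ cong (k *_) (coeff≡∑ z _) ⟨
    k * coeff z (inv bf ∘ g)                    ∎

  coeff-⊗-single : ∀ y {h} (bh : Invertible h) g → coeff (y ⊗ single h) g ≈ coeff y (g ∘ inv bh)
  coeff-⊗-single y {h} bh g = begin
    coeff (y ⊗ single h) g                         ≈⟨ coeff-⊗ y (single h) g ⟩
    ∑ y (λ (k , f) → δ (f ∘ h) g (k * 1#) + 0#)    ≈⟨ ∑-cong y (λ _ → +-identityʳ _) ⟩
    ∑ y (λ (k , f) → δ (f ∘ h) g (k * 1#))         ≈⟨ ∑-δ-∘ʳ y bh 1# g ⟩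
    coeff y (g ∘ inv bh) * 1#                      ≈⟨ *-identityʳ _ ⟩
    coeff y (g ∘ inv bh)                           ∎

  coeff-single-⊗ : ∀ y {f} (bf : Invertible f) g → coeff (single f ⊗ y) g ≈ coeff y (inv bf ∘ g)
  coeff-single-⊗ y {f} bf g = begin
    coeff (single f ⊗ y) g                              ≈⟨ coeff-⊗ (single f) y g ⟩
    ∑ y (λ (k′ , f′) → δ (f ∘ f′) g (1# * k′)) + 0#     ≈⟨ +-identityʳ _ ⟩
    ∑ y (λ (k′ , f′) → δ (f ∘ f′) g (1# * k′))          ≈⟨ ∑-δ-∘ˡ y bf 1# g ⟩
    1# * coeff y (inv bf ∘ g)                           ≈⟨ *-identityˡ _ ⟩
    coeff y (inv bf ∘ g)                                ∎

  coeff-⊗-++ : ∀ y w₁ w₂ g → coeff (y ⊗ (w₁ ++ w₂)) g ≈ coeff (y ⊗ w₁) g + coeff (y ⊗ w₂) g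
  coeff-⊗-++ y w₁ w₂ g = begin
    coeff (y ⊗ (w₁ ++ w₂)) g                                                      ≈⟨ coeff-⊗ y (w₁ ++ w₂) g ⟩
    ∑ y (λ (k , f) → ∑ (w₁ ++ w₂) (λ (k′ , f′) → δ (f ∘ f′) g (k * k′)))          ≈⟨ ∑-cong y (λ _ → ∑-++ w₁ w₂ _) ⟩
    ∑ y (λ (k , f) → ∑ w₁ (λ (k′ , f′) → δ (f ∘ f′) g (k * k′))
                   + ∑ w₂ (λ (k′ , f′) → δ (f ∘ f′) g (k * k′)))                 ≈⟨ ∑-∙ y _ _ ⟩
    ∑ y (λ (k , f) → ∑ w₁ (λ (k′ , f′) → δ (f ∘ f′) g (k * k′)))
      + ∑ y (λ (k , f) → ∑ w₂ (λ (k′ , f′) → δ (f ∘ f′) g (k * k′)))             ≈⟨ +-cong (coeff-⊗ y w₁ g) (coeff-⊗ y w₂ g) ⟨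
    coeff (y ⊗ w₁) g + coeff (y ⊗ w₂) g                                           ∎

  -- so that oneMinus y is definitionally one ⊕ neg y
  neg : GA → GA
  neg x = L.drop 1 (oneMinus x)

  coeff-neg : ∀ x g → coeff (neg x) g ≈ - coeff x g
  coeff-neg []            g = ≈-sym -0#≈0#
  coeff-neg ((k , f) ∷ x) g = ≈-trans (+-cong (δ-neg f g k) (coeff-neg x g)) (-‿+-comm _ _)

  ⊗-congˡ : ∀ {y y′} w → AllPerms Invertible w → y ≋ y′ → y ⊗ w ≋ y′ ⊗ w
  ⊗-congˡ {y} {y′} w bw y≋y′ g = begin
    coeff (y ⊗ w) g                                               ≈⟨ coeff-⊗ y w g ⟩
    ∑ y (λ (k , f) → ∑ w (λ (k′ , f′) → δ (f ∘ f′) g (k * k′)))   ≈⟨ ∑-swap y w _ ⟩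
    ∑ w (λ (k′ , f′) → ∑ y (λ (k , f) → δ (f ∘ f′) g (k * k′)))   ≈⟨ ∑-congᴬ w (All.map through bw) ⟩
    ∑ w (λ (k′ , f′) → ∑ y′ (λ (k , f) → δ (f ∘ f′) g (k * k′)))  ≈⟨ ∑-swap y′ w _ ⟨
    ∑ y′ (λ (k , f) → ∑ w (λ (k′ , f′) → δ (f ∘ f′) g (k * k′)))  ≈⟨ coeff-⊗ y′ w g ⟨
    coeff (y′ ⊗ w) g                                              ∎
    where
    through : ∀ {t} → Invertible (proj₂ t) →
              ∑ y (λ (k , f) → δ (f ∘ proj₂ t) g (k * proj₁ t)) ≈ ∑ y′ (λ (k , f) → δ (f ∘ proj₂ t) g (k * proj₁ t))
    through bt = ≈-trans (∑-δ-∘ʳ y bt _ g) (≈-trans (*-congʳ (y≋y′ _)) (≈-sym (∑-δ-∘ʳ y′ bt _ g)))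

  ⊗-congʳ : ∀ x {y y′} → AllPerms Invertible x → y ≋ y′ → x ⊗ y ≋ x ⊗ y′
  ⊗-congʳ x {y} {y′} bx y≋y′ g = begin
    coeff (x ⊗ y) g                                               ≈⟨ coeff-⊗ x y g ⟩
    ∑ x (λ (k , f) → ∑ y (λ (k′ , f′) → δ (f ∘ f′) g (k * k′)))   ≈⟨ ∑-congᴬ x (All.map through bx) ⟩
    ∑ x (λ (k , f) → ∑ y′ (λ (k′ , f′) → δ (f ∘ f′) g (k * k′)))  ≈⟨ coeff-⊗ x y′ g ⟨
    coeff (x ⊗ y′) g                                              ∎
    where
    through : ∀ {s} → Invertible (proj₂ s) →
              ∑ y (λ (k′ , f′) → δ (proj₂ s ∘ f′) g (proj₁ s * k′)) ≈ ∑ y′ (λ (k′ , f′) → δ (proj₂ s ∘ f′) g (proj₁ s * k′))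
    through bs = ≈-trans (∑-δ-∘ˡ y bs _ g) (≈-trans (*-congˡ (y≋y′ _)) (≈-sym (∑-δ-∘ˡ y′ bs _ g)))

  coeff-⊗⊗ʳ : ∀ x y z g → coeff (x ⊗ (y ⊗ z)) g
              ≈ ∑ x (λ (a , f) → ∑ y (λ (b , h) → ∑ z (λ (c , k) → δ (f ∘ h ∘ k) g (a * (b * c)))))
  coeff-⊗⊗ʳ x y z g = ≈-trans (coeff-⊗ x (y ⊗ z) g)
    (∑-cong x (λ (a , f) → ≈-trans (∑-concatMap _ y _) (reflexive (∑-cong≡ y (λ _ → ∑-map _ z _)))))

  coeff-⊗⊗ˡ : ∀ x y z g → coeff ((x ⊗ y) ⊗ z) g
              ≈ ∑ x (λ (a , f) → ∑ y (λ (b , h) → ∑ z (λ (c , k) → δ (f ∘ h ∘ k) g ((a * b) * c))))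
  coeff-⊗⊗ˡ x y z g = ≈-trans (coeff-⊗ (x ⊗ y) z g)
    (≈-trans (∑-concatMap _ x _) (reflexive (∑-cong≡ x (λ _ → ∑-map _ y _))))

  ⊗-assoc : ∀ x y z → x ⊗ (y ⊗ z) ≋ (x ⊗ y) ⊗ z
  ⊗-assoc x y z g = ≈-trans (coeff-⊗⊗ʳ x y z g) (≈-trans
    (∑-cong x (λ (a , f) → ∑-cong y (λ (b , h) → ∑-cong z (λ (c , k) → δ-congᶜ (f ∘ h ∘ k) g (≈-sym (*-assoc a b c))))))
    (≈-sym (coeff-⊗⊗ˡ x y z g)))

  ≋-pointwise : ∀ {x y} → Pointwise (λ (k , f) (k′ , f′) → k ≈ k′ × f ≗ f′) x y → x ≋ y
  ≋-pointwise [] g = ≈-refl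
  ≋-pointwise {(k , f) ∷ _} ((k≈k′ , f≗f′) ∷ x≋y) g = +-cong (δ-cong {f} f≗f′ (λ _ → refl) k≈k′) (≋-pointwise x≋y g)

  single-∘ : ∀ f h → single (f ∘ h) ≋ single f ⊗ single h
  single-∘ f h = ≋-pointwise {single (f ∘ h)} {single f ⊗ single h} ((≈-sym (*-identityˡ 1#) , (λ _ → refl)) ∷ [])

  ⊗-[] : ∀ {x} w → AllPerms Invertible w → x ≋ [] → x ⊗ w ≋ []
  ⊗-[] {x} w bw x≋[] = ⊗-congˡ {x} {[]} w bw x≋[]

  ⊗-comm : ∀ x y → All (λ (_ , f) → All (λ (_ , h) → f ∘ h ≗ h ∘ f) y) x → x ⊗ y ≋ y ⊗ x
  ⊗-comm x y commute g = begin
    coeff (x ⊗ y) g                                                ≈⟨ coeff-⊗ x y g ⟩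
    ∑ x (λ (a , f) → ∑ y (λ (b , h) → δ (f ∘ h) g (a * b)))        ≈⟨ ∑-congᴬ x (All.map (λ {(a , f)} fh≗hf →
                          ∑-congᴬ y (All.map (λ {(b , h)} e → δ-cong {f ∘ h} e (λ _ → refl) (*-comm a b)) fh≗hf)) commute) ⟩
    ∑ x (λ (a , f) → ∑ y (λ (b , h) → δ (h ∘ f) g (b * a)))        ≈⟨ ∑-swap x y _ ⟩
    ∑ y (λ (b , h) → ∑ x (λ (a , f) → δ (h ∘ f) g (b * a)))        ≈⟨ coeff-⊗ y x g ⟨
    coeff (y ⊗ x) g                                                ∎

  coeff-⊗-middle : ∀ x y z g → coeff (x ⊗ (y ⊗ z)) g ≈ ∑ y (λ (b , h) → b * coeff (x ⊗ (single h ⊗ z)) g)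
  coeff-⊗-middle x y z g = begin
    coeff (x ⊗ (y ⊗ z)) g                                                                       ≈⟨ coeff-⊗⊗ʳ x y z g ⟩
    ∑ x (λ (a , f) → ∑ y (λ (b , h) → ∑ z (λ (c , k) → δ (f ∘ h ∘ k) g (a * (b * c)))))         ≈⟨ ∑-swap x y _ ⟩
    ∑ y (λ (b , h) → ∑ x (λ (a , f) → ∑ z (λ (c , k) → δ (f ∘ h ∘ k) g (a * (b * c)))))         ≈⟨ ∑-cong y pull ⟩
    ∑ y (λ (b , h) → b * ∑ x (λ (a , f) → ∑ z (λ (c , k) → δ (f ∘ h ∘ k) g (a * (1# * c))) + 0#)) ≈⟨ ∑-cong y (λ (b , h) →
                                                                                                  *-congˡ (coeff-⊗⊗ʳ x (single h) z g)) ⟨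
    ∑ y (λ (b , h) → b * coeff (x ⊗ (single h ⊗ z)) g)                                          ∎
    where
    a[bc]≈b[a[1c]] : ∀ a b c → a * (b * c) ≈ b * (a * (1# * c))
    a[bc]≈b[a[1c]] a b c = ≈-trans (≈-sym (*-assoc _ _ _)) (≈-trans (*-congʳ (*-comm a b))
                             (≈-trans (*-assoc _ _ _) (*-congˡ (*-congˡ (≈-sym (*-identityˡ c))))))
    pull : ∀ ((b , h) : Term) → ∑ x (λ (a , f) → ∑ z (λ (c , k) → δ (f ∘ h ∘ k) g (a * (b * c))))
                               ≈ b * ∑ x (λ (a , f) → ∑ z (λ (c , k) → δ (f ∘ h ∘ k) g (a * (1# * c))) + 0#)
    pull (b , h) = ≈-trans (∑-cong x (λ (a , f) → ≈-trans
      (∑-cong z (λ (c , k) → ≈-trans (δ-congᶜ (f ∘ h ∘ k) g (a[bc]≈b[a[1c]] a b c)) (δ-*ˡ (f ∘ h ∘ k) g b _))) (∑-*ˡ z b _)))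
      (≈-trans (∑-*ˡ x b _) (*-congˡ (∑-cong x (λ _ → ≈-sym (+-identityʳ _)))))

  ⊗-middle-vanishes : ∀ x y z → All (λ (_ , h) → x ⊗ (single h ⊗ z) ≋ []) y → x ⊗ (y ⊗ z) ≋ []
  ⊗-middle-vanishes x y z vanish g = begin
    coeff (x ⊗ (y ⊗ z)) g                                 ≈⟨ coeff-⊗-middle x y z g ⟩
    ∑ y (λ (b , h) → b * coeff (x ⊗ (single h ⊗ z)) g)    ≈⟨ ∑-vanishes y (All.map (λ {(b , h)} e → ≈-trans (*-congˡ (e g)) (zeroʳ b)) vanish) ⟩
    0#                                                    ∎

  AllPerms-⊗ : ∀ {p} {P : Perm → Set p} → (∀ {f h} → P f → P h → P (f ∘ h)) →
               ∀ x y → AllPerms P x → AllPerms P y → AllPerms P (x ⊗ y)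
  AllPerms-⊗ _∘ᴾ_ []      y []         py = []
  AllPerms-⊗ _∘ᴾ_ (_ ∷ x) y (pf ∷ px) py = Allₚ.++⁺ (Allₚ.map⁺ (All.map (pf ∘ᴾ_) py)) (AllPerms-⊗ _∘ᴾ_ x y px py)

  AllPerms-prod : ∀ {p} {P : Perm → Set p} → (∀ {f h} → P f → P h → P (f ∘ h)) → P id →
                  ∀ xs → All (AllPerms P) xs → AllPerms P (prod xs)
  AllPerms-prod _∘ᴾ_ pid []       []         = pid ∷ []
  AllPerms-prod _∘ᴾ_ pid (x ∷ xs) (px ∷ pxs) = AllPerms-⊗ _∘ᴾ_ x (prod xs) px (AllPerms-prod _∘ᴾ_ pid xs pxs)

  AllPerms-invertible-⊗ : ∀ x y → AllPerms Invertible x → AllPerms Invertible y → AllPerms Invertible (x ⊗ y)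
  AllPerms-invertible-⊗ = AllPerms-⊗ ∘-invertible

  ⊗-neg : ∀ x y → x ⊗ neg y ≋ neg (x ⊗ y)
  ⊗-neg x y g = begin
    coeff (x ⊗ neg y) g                                            ≈⟨ coeff-⊗ x (neg y) g ⟩
    ∑ x (λ (a , f) → ∑ (neg y) (λ (b , h) → δ (f ∘ h) g (a * b)))  ≡⟨ ∑-cong≡ x (λ _ → ∑-map _ y _) ⟩
    ∑ x (λ (a , f) → ∑ y (λ (b , h) → δ (f ∘ h) g (a * - b)))      ≈⟨ ∑-cong x (λ (a , f) → ≈-trans (∑-cong y (λ (b , h) →
                         ≈-trans (δ-congᶜ (f ∘ h) g (≈-sym (-‿distribʳ-* a b))) (δ-neg (f ∘ h) g _))) (∑-neg y _)) ⟩
    ∑ x (λ (a , f) → - ∑ y (λ (b , h) → δ (f ∘ h) g (a * b)))      ≈⟨ ∑-neg x _ ⟩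
    - ∑ x (λ (a , f) → ∑ y (λ (b , h) → δ (f ∘ h) g (a * b)))      ≈⟨ -‿cong (coeff-⊗ x y g) ⟨
    - coeff (x ⊗ y) g                                              ≈⟨ coeff-neg (x ⊗ y) g ⟨
    coeff (neg (x ⊗ y)) g                                          ∎

  ≋neg⇒≋[] : ∀ {½} → (1# + 1#) * ½ ≈ 1# → ∀ x → x ≋ neg x → x ≋ []
  ≋neg⇒≋[] {½} 2½≈1 x x≋-x g = begin
    coeff x g                               ≈⟨ *-identityˡ _ ⟨
    1# * coeff x g                          ≈⟨ *-congʳ (≈-trans (≈-sym 2½≈1) (*-comm _ _)) ⟩
    (½ * (1# + 1#)) * coeff x g             ≈⟨ *-assoc _ _ _ ⟩
    ½ * ((1# + 1#) * coeff x g)             ≈⟨ *-congˡ (distribʳ _ _ _) ⟩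
    ½ * (1# * coeff x g + 1# * coeff x g)   ≈⟨ *-congˡ (+-cong (*-identityˡ _) (≈-trans (*-identityˡ _) (≈-trans (x≋-x g) (coeff-neg x g)))) ⟩
    ½ * (coeff x g + - coeff x g)           ≈⟨ *-congˡ (-‿inverseʳ _) ⟩
    ½ * 0#                                  ≈⟨ zeroʳ ½ ⟩
    0#                                      ∎

  sgn-cong : ∀ {f h} → f ≗ h → sgn f ≈ sgn h
  sgn-cong f≗h = reflexive (cong (λ k → if even k then 1# else - 1#) (Parity.inversions-cong f≗h))

  sgn-flip : ∀ {b b′} → b′ ≡ not b → (if b′ then 1# else - 1#) ≈ - (if b then 1# else - 1#)
  sgn-flip {true}  refl = ≈-refl
  sgn-flip {false} refl = ≈-sym (-‿involutive _)

  sgn-∘-transp : ∀ g → Injective _≡_ _≡_ g → ∀ x y → x ≢ y → sgn (g ∘ transp x y) ≈ - sgn g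
  sgn-∘-transp g g-inj x y x≢y = sgn-flip (parity-∘-transp g g-inj x y x≢y)

  sgn-transp-∘ : ∀ g → Invertible g → ∀ x y → x ≢ y → sgn (transp x y ∘ g) ≈ - sgn g
  sgn-transp-∘ g bg x y x≢y = sgn-flip (parity-transp-∘ g bg x y x≢y)

  eqV : ∀ {k} → Vec (Fin n) k → (Fin k → Fin n) → Bool
  eqV []      h = true
  eqV (x ∷ v) h = (x == h zero) ∧ eqV v (h ∘ suc)

  eqV⇒≗ : ∀ {k} (v : Vec (Fin n) k) h → eqV v h ≡ true → V.lookup v ≗ h
  eqV⇒≗ (x ∷ v) h e zero    = ==⇒≡ (proj₁ (∧-true e))
  eqV⇒≗ (x ∷ v) h e (suc i) = eqV⇒≗ v (h ∘ suc) (proj₂ (∧-true {x == h zero} e)) i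

  ≗⇒eqV : ∀ {k} (v : Vec (Fin n) k) h → V.lookup v ≗ h → eqV v h ≡ true
  ≗⇒eqV []      h _     = refl
  ≗⇒eqV (x ∷ v) h v≗h = true-∧ (≡⇒== (v≗h zero)) (≗⇒eqV v (h ∘ suc) (v≗h ∘ suc))

  eqMap-lookup : (v : Vec (Fin n) n) (g : Perm) → eqMap (V.lookup v) g ≡ eqV v g
  eqMap-lookup v g = bool-ext (λ e → ≗⇒eqV v g (eqMap⇒≗ {f = V.lookup v} {g = g} e)) (λ e → ≗⇒eqMap (eqV⇒≗ v g e))

  ∑-allVecs-δ : ∀ k (h : Fin k → Fin n) → ∑ (allVecs n k) (λ v → if eqV v h then 1# else 0#) ≈ 1#
  ∑-allVecs-δ zero    h = +-identityʳ 1#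
  ∑-allVecs-δ (suc k) h = begin
    ∑ (allVecs n (suc k)) (λ v → if eqV v h then 1# else 0#)                                    ≈⟨ ∑-concatMap _ (allFin n) _ ⟩
    ∑ (allFin n) (λ x → ∑ (map (x ∷_) (allVecs n k)) (λ v → if eqV v h then 1# else 0#))       ≡⟨ ∑-cong≡ (allFin n) (λ x →
                                                                                                    ∑-map (x ∷_) (allVecs n k) _) ⟩
    ∑ (allFin n) (λ x → ∑ (allVecs n k) (λ v → if (x == h zero) ∧ eqV v (h ∘ suc) then 1# else 0#)) ≈⟨ ∑-cong (allFin n) head ⟩
    ∑ (allFin n) (λ x → if x == h zero then 1# else 0#)                                         ≈⟨ ∑-δ (h zero) (λ _ → 1#) ⟩
    1#                                                                                          ∎
    where
    head : ∀ x → ∑ (allVecs n k) (λ v → if (x == h zero) ∧ eqV v (h ∘ suc) then 1# else 0#) ≈ (if x == h zero then 1# else 0#)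
    head x with x == h zero
    ... | true  = ∑-allVecs-δ k (h ∘ suc)
    ... | false = ∑-ε (allVecs n k)

  ∑-allMaps-sift : (w : Perm → Carrier) → (∀ {f h} → f ≗ h → w f ≈ w h) → ∀ g → ∑ (allMaps n) (λ f → δ f g (w f)) ≈ w g
  ∑-allMaps-sift w w-cong g = begin
    ∑ (allMaps n) (λ f → δ f g (w f))          ≈⟨ ∑-cong (allMaps n) at ⟩
    ∑ (allMaps n) (λ f → δ f g 1# * w g)       ≈⟨ ∑-*ʳ (allMaps n) (w g) _ ⟩
    ∑ (allMaps n) (λ f → δ f g 1#) * w g       ≡⟨ cong (_* w g) (∑-map V.lookup (allVecs n n) _) ⟩
    ∑ (allVecs n n) (λ v → δ (V.lookup v) g 1#) * w g ≡⟨ cong (_* w g) (∑-cong≡ (allVecs n n) (λ v →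
                                                   cong (λ b → if b then 1# else 0#) (eqMap-lookup v g))) ⟩
    ∑ (allVecs n n) (λ v → if eqV v g then 1# else 0#) * w g ≈⟨ *-congʳ (∑-allVecs-δ n g) ⟩
    1# * w g                                   ≈⟨ *-identityˡ _ ⟩
    w g                                        ∎
    where
    at : ∀ f → δ f g (w f) ≈ δ f g 1# * w g
    at f with eqMap f g in e
    ... | true  = ≈-trans (w-cong (eqMap⇒≗ {f = f} {g = g} e)) (≈-sym (*-identityˡ _))
    ... | false = ≈-sym (zeroˡ _)

  ∑-filter : ∀ {a} {A : Set a} (b : A → Bool) xs (w : A → Carrier) →
             ∑ (filter (λ x → T? (b x)) xs) w ≈ ∑ xs (λ x → if b x then w x else 0#)
  ∑-filter b []       w = ≈-refl
  ∑-filter b (x ∷ xs) w with b x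
  ... | true  = +-congˡ (∑-filter b xs w)
  ... | false = ≈-trans (∑-filter b xs w) (≈-sym (+-identityˡ _))

  coeff-symGroup : ∀ X (w : Perm → Carrier) → (∀ {f h} → f ≗ h → w f ≈ w h) → ∀ g →
                   coeff (map (λ f → (w f , f)) (symGroup n X)) g ≈ (if inSymB X g then w g else 0#)
  coeff-symGroup X w w-cong g = begin
    coeff (map (λ f → (w f , f)) (symGroup n X)) g                      ≡⟨ coeff≡∑ (map (λ f → (w f , f)) (symGroup n X)) g ⟩
    ∑ (map (λ f → (w f , f)) (symGroup n X)) (termCoeff g)              ≡⟨ ∑-map _ (symGroup n X) _ ⟩
    ∑ (symGroup n X) (λ f → δ f g (w f))                                ≈⟨ ∑-filter (inSymB X) (allMaps n) _ ⟩
    ∑ (allMaps n) (λ f → if inSymB X f then δ f g (w f) else 0#)        ≈⟨ ∑-cong (allMaps n) δ-inside ⟩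
    ∑ (allMaps n) (λ f → δ f g (if inSymB X f then w f else 0#))        ≈⟨ ∑-allMaps-sift _ w′-cong g ⟩
    (if inSymB X g then w g else 0#)                                    ∎
    where
    δ-inside : ∀ f → (if inSymB X f then δ f g (w f) else 0#) ≈ δ f g (if inSymB X f then w f else 0#)
    δ-inside f with inSymB X f | eqMap f g
    ... | true  | _     = ≈-refl
    ... | false | true  = ≈-refl
    ... | false | false = ≈-refl
    w′-cong : ∀ {f h} → f ≗ h → (if inSymB X f then w f else 0#) ≈ (if inSymB X h then w h else 0#)
    w′-cong {f} {h} f≗h with inSymB X f | inSymB X h | inSymB-cong X f≗h
    ... | true  | .true  | refl = w-cong f≗h
    ... | false | .false | refl = ≈-refl

  coeff-𝔞 : ∀ X g → coeff (𝔞 X) g ≈ (if inSymB X g then 1# else 0#)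
  coeff-𝔞 X = coeff-symGroup X (λ _ → 1#) (λ _ → ≈-refl)

  sgnOn : List (Fin n) → Perm → Carrier
  sgnOn X g = if inSymB X g then sgn g else 0#

  sgnOn-∈ : ∀ {X} {g} → InSym X g → sgnOn X g ≈ sgn g
  sgnOn-∈ {X} {g} g∈ rewrite InSym⇒inSymB X g g∈ = ≈-refl

  sgnOn-∉ : ∀ {X} {g} → ¬ InSym X g → sgnOn X g ≈ 0#
  sgnOn-∉ {X} {g} g∉ rewrite ¬InSym⇒inSymB X g g∉ = ≈-refl

  coeff-𝔟 : ∀ X g → coeff (𝔟 X) g ≈ sgnOn X g
  coeff-𝔟 X = coeff-symGroup X sgn sgn-cong

  AllPerms-InSym-symGroup : ∀ X (w : Perm → Carrier) → AllPerms (InSym X) (map (λ f → (w f , f)) (symGroup n X))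
  AllPerms-InSym-symGroup X w = Allₚ.map⁺ (All.map (λ T-f∈ → inSymB⇒InSym X _ (Equivalence.to T-≡ T-f∈))
                                                   (Allₚ.all-filter (λ f → T? (inSymB X f)) (allMaps n)))

  AllPerms-InSym-𝔞 : ∀ X → AllPerms (InSym X) (𝔞 X)
  AllPerms-InSym-𝔞 X = AllPerms-InSym-symGroup X (λ _ → 1#)

  AllPerms-InSym-𝔟 : ∀ X → AllPerms (InSym X) (𝔟 X)
  AllPerms-InSym-𝔟 X = AllPerms-InSym-symGroup X sgn

  AllPerms-invertible-𝔞 : ∀ X → AllPerms Invertible (𝔞 X)
  AllPerms-invertible-𝔞 X = All.map InSym⇒invertible (AllPerms-InSym-𝔞 X)

  AllPerms-invertible-𝔟 : ∀ X → AllPerms Invertible (𝔟 X)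
  AllPerms-invertible-𝔟 X = All.map InSym⇒invertible (AllPerms-InSym-𝔟 X)

  AllPerms-invertible-𝔞row : ∀ T → AllPerms Invertible (𝔞row T)
  AllPerms-invertible-𝔞row T = AllPerms-prod ∘-invertible id-invertible (map 𝔞 T)
    (Allₚ.map⁺ (All.tabulate (λ {X} _ → AllPerms-invertible-𝔞 X)))

  transp-⊗-𝔟 : ∀ {X x y} → x ∈ X → y ∈ X → x ≢ y → single (transp x y) ⊗ 𝔟 X ≋ neg (𝔟 X)
  transp-⊗-𝔟 {X} {x} {y} x∈X y∈X x≢y g = begin
    coeff (single τ ⊗ 𝔟 X) g   ≈⟨ coeff-single-⊗ (𝔟 X) (transp-invertible x y) g ⟩
    coeff (𝔟 X) (τ ∘ g)        ≈⟨ coeff-𝔟 X (τ ∘ g) ⟩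
    sgnOn X (τ ∘ g)            ≈⟨ flip (inSymB X g) refl ⟩
    - sgnOn X g                ≈⟨ -‿cong (coeff-𝔟 X g) ⟨
    - coeff (𝔟 X) g            ≈⟨ coeff-neg (𝔟 X) g ⟨
    coeff (neg (𝔟 X)) g        ∎
    where
    τ : Perm
    τ = transp x y
    τ∈ : InSym X τ
    τ∈ = transp-InSym x∈X y∈X
    flip : ∀ b → inSymB X g ≡ b → sgnOn X (τ ∘ g) ≈ - sgnOn X g
    flip true  e = let g∈ = inSymB⇒InSym X g e in
      ≈-trans (sgnOn-∈ (InSym-∘ τ∈ g∈)) (≈-trans (sgn-transp-∘ g (InSym⇒invertible g∈) x y x≢y) (-‿cong (≈-sym (sgnOn-∈ g∈))))
    flip false e = ≈-trans (sgnOn-∉ τg∉) (≈-trans (≈-sym -0#≈0#) (-‿cong (≈-sym (reflexive (cong (λ b → if b then sgn g else 0#) e)))))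
      where
      τg∉ : ¬ InSym X (τ ∘ g)
      τg∉ τg∈ with () ← trans (sym e) (InSym⇒inSymB X g (InSym-cong (transp-involutive x y ∘ g) (InSym-∘ τ∈ τg∈)))

  coeff-⊗-transps : ∀ y d Bs g → coeff (y ⊗ map (λ b → (1# , transp d b)) Bs) g ≈ ∑ Bs (λ b → coeff y (g ∘ transp d b))
  coeff-⊗-transps y d []       g = ≈-trans (coeff-⊗ y [] g) (∑-ε y)
  coeff-⊗-transps y d (b ∷ Bs) g =
    ≈-trans (coeff-⊗-++ y (single (transp d b)) _ g) (+-cong (coeff-⊗-single y (transp-invertible d b) g) (coeff-⊗-transps y d Bs g))

  -- The identity and the (d b), b ∈ C, are coset representatives of 𝔖_C in 𝔖_{d ∷ C}.
  module Coset (C : List (Fin n)) (C-unique : Unique C) (d : Fin n) (d∉C : d ∉ C) where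

    zᵈ : GA
    zᵈ = map (λ b → (1# , transp d b)) C

    d≢ : ∀ {b} → b ∈ C → d ≢ b
    d≢ b∈C d≡b = d∉C (subst (_∈ C) (sym d≡b) b∈C)

    transp-d-InSym : ∀ {b} → b ∈ C → InSym (d ∷ C) (transp d b)
    transp-d-InSym b∈C = transp-InSym (here refl) (there b∈C)

    coset-rhs : Perm → Carrier
    coset-rhs g = sgnOn C g + ∑ C (λ b → - sgnOn C (g ∘ transp d b))

    ∘transp-∉ : ∀ {g b} → ¬ InSym (d ∷ C) g → b ∈ C → ¬ InSym C (g ∘ transp d b)
    ∘transp-∉ {g} {b} g∉ b∈C gτ∈ = g∉ (InSym-cong (cong g ∘ transp-involutive d b) (InSym-∘ (InSym-⊆ there gτ∈) (transp-d-InSym b∈C)))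

    coset-outside : ∀ {g} → ¬ InSym (d ∷ C) g → coset-rhs g ≈ sgnOn (d ∷ C) g
    coset-outside {g} g∉ = begin
      sgnOn C g + ∑ C (λ b → - sgnOn C (g ∘ transp d b))   ≈⟨ +-cong (sgnOn-∉ {C} {g} (g∉ ∘ InSym-⊆ there))
                                                                  (∑-vanishes C (All.tabulate (λ {b} b∈C →
                                                                     ≈-trans (-‿cong (sgnOn-∉ {C} {g ∘ transp d b} (∘transp-∉ g∉ b∈C))) -0#≈0#))) ⟩
      0# + 0#                                              ≈⟨ +-identityʳ _ ⟩
      0#                                                   ≈⟨ sgnOn-∉ g∉ ⟨
      sgnOn (d ∷ C) g                                      ∎

    coset-fixing : ∀ {g} → InSym (d ∷ C) g → g d ≡ d → coset-rhs g ≈ sgnOn (d ∷ C) g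
    coset-fixing {g} g∈ gd≡d = begin
      sgnOn C g + ∑ C (λ b → - sgnOn C (g ∘ transp d b))   ≈⟨ +-cong (sgnOn-∈ g∈C)
                                                                  (∑-vanishes C (All.tabulate (λ {b} b∈C →
                                                                     ≈-trans (-‿cong (sgnOn-∉ {C} {g ∘ transp d b} (gτ∉ b∈C))) -0#≈0#))) ⟩
      sgn g + 0#                                           ≈⟨ +-identityʳ _ ⟩
      sgn g                                                ≈⟨ sgnOn-∈ g∈ ⟨
      sgnOn (d ∷ C) g                                      ∎
      where
      g∈C : InSym C g
      g∈C = inSym (injective g∈) λ i i∉C → case i ≟F d of λ where
        (yes refl) → gd≡d
        (no i≢d)   → fixed g∈ i λ { (here i≡d) → i≢d i≡d ; (there i∈C) → i∉C i∈C }
      -- g ∘ (d b) sends d to g b ≠ g d = d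
      gτ∉ : ∀ {b} → b ∈ C → ¬ InSym C (g ∘ transp d b)
      gτ∉ {b} b∈C gτ∈ = d≢ b∈C (injective g∈ (trans gd≡d (sym (trans (cong g (sym (transp-≡ˡ d b))) (fixed gτ∈ d d∉C)))))

    coset-moving : ∀ {g} → InSym (d ∷ C) g → g d ≢ d → coset-rhs g ≈ sgnOn (d ∷ C) g
    coset-moving {g} g∈ gd≢d = begin
      sgnOn C g + ∑ C (λ b → - sgnOn C (g ∘ transp d b))   ≈⟨ +-cong (sgnOn-∉ {C} {g} (λ g∈C → gd≢d (fixed g∈C d d∉C)))
                                                                  (∑-single-support C C-unique b₀∈C _ others-vanish) ⟩
      0# + - sgnOn C (g ∘ transp d b₀)                     ≈⟨ +-identityˡ _ ⟩
      - sgnOn C (g ∘ transp d b₀)                          ≈⟨ -‿cong (sgnOn-∈ gτ₀∈C) ⟩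
      - sgn (g ∘ transp d b₀)                              ≈⟨ -‿cong (sgn-∘-transp g (injective g∈) d b₀ d≢b₀) ⟩
      - - sgn g                                            ≈⟨ -‿involutive _ ⟩
      sgn g                                                ≈⟨ sgnOn-∈ g∈ ⟨
      sgnOn (d ∷ C) g                                      ∎
      where
      bg : Invertible g
      bg = InSym⇒invertible g∈
      b₀ : Fin n
      b₀ = inv bg d
      gb₀≡d : g b₀ ≡ d
      gb₀≡d = f∘inv bg d
      d≢b₀ : d ≢ b₀
      d≢b₀ d≡b₀ = gd≢d (trans (cong g d≡b₀) gb₀≡d)
      b₀∈C : b₀ ∈ C
      b₀∈C with b₀ ∈? C
      ... | yes b₀∈C = b₀∈C
      ... | no b₀∉C  = ⊥-elim (d≢b₀ (trans (sym gb₀≡d) (fixed g∈ b₀ λ { (here b₀≡d) → d≢b₀ (sym b₀≡d) ; (there b₀∈C) → b₀∉C b₀∈C })))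
      gτ₀∈C : InSym C (g ∘ transp d b₀)
      gτ₀∈C = inSym (transp-injective d b₀ ∘ injective g∈) λ i i∉C → case i ≟F d of λ where
        (yes refl) → trans (cong g (transp-≡ˡ i b₀)) gb₀≡d
        (no i≢d)   → trans (cong g (transp-≢ d b₀ i i≢d (λ i≡b₀ → i∉C (subst (_∈ C) (sym i≡b₀) b₀∈C))))
                           (fixed g∈ i λ { (here i≡d) → i≢d i≡d ; (there i∈C) → i∉C i∈C })
      -- only b₀ can send d back to d
      others-vanish : ∀ b → b ∈ C → b ≢ b₀ → - sgnOn C (g ∘ transp d b) ≈ 0#
      others-vanish b b∈C b≢b₀ = ≈-trans (-‿cong (sgnOn-∉ {C} {g ∘ transp d b} λ gτ∈C → b≢b₀ (injective g∈
        (trans (trans (cong g (sym (transp-≡ˡ d b))) (fixed gτ∈C d d∉C)) (sym gb₀≡d))))) -0#≈0#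

    coset : 𝔟 C ⊗ oneMinus zᵈ ≋ 𝔟 (d ∷ C)
    coset g = begin
      coeff (𝔟 C ⊗ oneMinus zᵈ) g                            ≈⟨ coeff-⊗-++ (𝔟 C) one (neg zᵈ) g ⟩
      coeff (𝔟 C ⊗ one) g + coeff (𝔟 C ⊗ neg zᵈ) g          ≈⟨ +-cong (coeff-⊗-single (𝔟 C) id-invertible g) (⊗-neg (𝔟 C) zᵈ g) ⟩
      coeff (𝔟 C) g + coeff (neg (𝔟 C ⊗ zᵈ)) g              ≈⟨ +-congˡ (coeff-neg (𝔟 C ⊗ zᵈ) g) ⟩
      coeff (𝔟 C) g + - coeff (𝔟 C ⊗ zᵈ) g                  ≈⟨ +-congˡ (-‿cong (coeff-⊗-transps (𝔟 C) d C g)) ⟩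
      coeff (𝔟 C) g + - ∑ C (λ b → coeff (𝔟 C) (g ∘ transp d b)) ≈⟨ +-cong (coeff-𝔟 C g) (≈-trans (-‿cong (∑-cong C (λ b →
                                                                     coeff-𝔟 C (g ∘ transp d b)))) (≈-sym (∑-neg C _))) ⟩
      coset-rhs g                                            ≈⟨ by-cases ⟩
      sgnOn (d ∷ C) g                                        ≈⟨ coeff-𝔟 (d ∷ C) g ⟨
      coeff (𝔟 (d ∷ C)) g                                    ∎
      where
      by-cases : coset-rhs g ≈ sgnOn (d ∷ C) g
      by-cases with InSym? (d ∷ C) g | g d ≟F d
      ... | no g∉  | _        = coset-outside g∉
      ... | yes g∈ | yes gd≡d = coset-fixing g∈ gd≡d
      ... | yes g∈ | no gd≢d  = coset-moving g∈ gd≢d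

  ConjugateTerms : Perm → Term → Term → Set ℓ
  ConjugateTerms σ (k , f) (k′ , f′) = k ≈ k′ × σ ∘ f ≗ f′ ∘ σ

  single-⊗-conj : ∀ σ {y y′} → Pointwise (ConjugateTerms σ) y y′ → single σ ⊗ y ≋ y′ ⊗ single σ
  single-⊗-conj σ {y} {y′} y~y′ g = begin
    coeff (single σ ⊗ y) g                                ≈⟨ coeff-⊗ (single σ) y g ⟩
    ∑ y (λ (k , f) → δ (σ ∘ f) g (1# * k)) + 0#           ≈⟨ +-identityʳ _ ⟩
    ∑ y (λ (k , f) → δ (σ ∘ f) g (1# * k))                ≈⟨ termwise y~y′ ⟩
    ∑ y′ (λ (k′ , f′) → δ (f′ ∘ σ) g (k′ * 1#) + 0#)      ≈⟨ coeff-⊗ y′ (single σ) g ⟨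
    coeff (y′ ⊗ single σ) g                               ∎
    where
    termwise : ∀ {y y′} → Pointwise (ConjugateTerms σ) y y′ →
               ∑ y (λ (k , f) → δ (σ ∘ f) g (1# * k)) ≈ ∑ y′ (λ (k′ , f′) → δ (f′ ∘ σ) g (k′ * 1#) + 0#)
    termwise [] = ≈-refl
    termwise {(k , f) ∷ _} ((k≈k′ , σf≗f′σ) ∷ y~y′) = +-cong
      (≈-trans (δ-cong {σ ∘ f} σf≗f′σ (λ _ → refl) (≈-trans (*-identityˡ _) (≈-trans k≈k′ (≈-sym (*-identityʳ _))))) (≈-sym (+-identityʳ _)))
      (termwise y~y′)

  Absorbs : GA → Perm → Set ℓ
  Absorbs A f = A ⊗ single f ≋ A

  Absorbs-id : ∀ A → Absorbs A id
  Absorbs-id A = coeff-⊗-single A id-invertible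

  𝔞-absorbs : ∀ R {ρ} → InSym R ρ → Absorbs (𝔞 R) ρ
  𝔞-absorbs R {ρ} ρ∈ g = begin
    coeff (𝔞 R ⊗ single ρ) g                    ≈⟨ coeff-⊗-single (𝔞 R) bρ g ⟩
    coeff (𝔞 R) (g ∘ inv bρ)                    ≈⟨ coeff-𝔞 R _ ⟩
    (if inSymB R (g ∘ inv bρ) then 1# else 0#)  ≡⟨ cong (λ b → if b then 1# else 0#) same-membership ⟩
    (if inSymB R g then 1# else 0#)             ≈⟨ coeff-𝔞 R g ⟨
    coeff (𝔞 R) g                               ∎
    where
    bρ : Invertible ρ
    bρ = InSym⇒invertible ρ∈
    same-membership : inSymB R (g ∘ inv bρ) ≡ inSymB R g
    same-membership = bool-ext
      (λ e → InSym⇒inSymB R g (InSym-cong {f = (g ∘ inv bρ) ∘ ρ} (cong g ∘ inv∘f bρ) (InSym-∘ {f = g ∘ inv bρ} (inSymB⇒InSym R _ e) ρ∈)))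
      (λ e → InSym⇒inSymB R _ (InSym-∘ (inSymB⇒InSym R g e) (InSym-inv ρ∈)))

module Symmetrizers {c ℓ} (K : CommutativeRing c ℓ) (n : ℕ) where
  open CommutativeRing K using (_≈_; 1#; _+_; _*_)
  open GroupAlgebra K n
  open GroupAlgebraProperties K n
  open import Relation.Binary.Reasoning.Setoid ≋-setoid

  Absorbs-∘ : ∀ {A} → AllPerms Invertible A → ∀ {f h} → Invertible h → Absorbs A f → Absorbs A h → Absorbs A (f ∘ h)
  Absorbs-∘ {A} bA {f} {h} bh Af Ah = begin
    A ⊗ single (f ∘ h)            ≈⟨ ⊗-congʳ A bA (single-∘ f h) ⟩
    A ⊗ (single f ⊗ single h)     ≈⟨ ⊗-assoc A (single f) (single h) ⟩
    (A ⊗ single f) ⊗ single h     ≈⟨ ⊗-congˡ {A ⊗ single f} {A} (single h) (bh ∷ []) Af ⟩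
    A ⊗ single h                  ≈⟨ Ah ⟩
    A                             ∎

  AllPerms-InSym-𝔞row : ∀ rows → AllPerms (InSym (concat rows)) (𝔞row rows)
  AllPerms-InSym-𝔞row rows = AllPerms-prod InSym-∘ InSym-id (map 𝔞 rows)
    (Allₚ.map⁺ (All.tabulate (λ {R} R∈rows → All.map (InSym-⊆ (λ x∈R → ∈-concat⁺′ x∈R R∈rows)) (AllPerms-InSym-𝔞 R))))

  -- Permutations of one row commute with the row symmetrizers of the other rows.
  𝔞row-absorbs : ∀ rows → Unique (concat rows) → ∀ {R} → R ∈ rows → ∀ {ρ} → InSym R ρ → Absorbs (𝔞row rows) ρ
  𝔞row-absorbs (R₁ ∷ rest) rows-unique {R} R∈rows {ρ} ρ∈ = begin
    (𝔞 R₁ ⊗ A′) ⊗ single ρ     ≈⟨ ⊗-assoc (𝔞 R₁) A′ (single ρ) ⟨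
    𝔞 R₁ ⊗ (A′ ⊗ single ρ)     ≈⟨ absorbed R∈rows ⟩
    𝔞 R₁ ⊗ A′                  ∎
    where
    A′ : GA
    A′ = 𝔞row rest
    split = Unique-++⁻ R₁ rows-unique
    absorbed : R ∈ R₁ ∷ rest → 𝔞 R₁ ⊗ (A′ ⊗ single ρ) ≋ 𝔞 R₁ ⊗ A′
    absorbed (here refl) = begin
      𝔞 R₁ ⊗ (A′ ⊗ single ρ)   ≈⟨ ⊗-congʳ (𝔞 R₁) (AllPerms-invertible-𝔞 R₁) (⊗-comm A′ (single ρ) (All.map (λ h∈ →
                                    (λ i → sym (InSym-commute ρ∈ (injective h∈) (λ x x∈R₁ → fixed h∈ x (λ x∈rest →
                                       proj₂ (proj₂ split) (x∈R₁ , x∈rest))) i)) ∷ []) (AllPerms-InSym-𝔞row rest))) ⟩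
      𝔞 R₁ ⊗ (single ρ ⊗ A′)   ≈⟨ ⊗-assoc (𝔞 R₁) (single ρ) A′ ⟩
      (𝔞 R₁ ⊗ single ρ) ⊗ A′   ≈⟨ ⊗-congˡ {𝔞 R₁ ⊗ single ρ} {𝔞 R₁} A′ (AllPerms-invertible-𝔞row rest) (𝔞-absorbs R₁ ρ∈) ⟩
      𝔞 R₁ ⊗ A′                ∎
    absorbed (there R∈rest) = ⊗-congʳ (𝔞 R₁) (AllPerms-invertible-𝔞 R₁) (𝔞row-absorbs rest (proj₁ (proj₂ split)) R∈rest ρ∈)

  transps : Fin n → List (Fin n) → GA
  transps x Bs = map (λ b → (1# , transp x b)) Bs

  AllPerms-invertible-oneMinus-transps : ∀ x Bs → AllPerms Invertible (oneMinus (transps x Bs))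
  AllPerms-invertible-oneMinus-transps x Bs =
    id-invertible ∷ Allₚ.map⁺ (Allₚ.map⁺ (All.tabulate (λ {b} _ → transp-invertible x b)))

  oneMinus-transps-conj : ∀ {σ} → Invertible σ → ∀ a Bs → (∀ b → b ∈ Bs → σ b ≡ b) →
                          single σ ⊗ oneMinus (transps a Bs) ≋ oneMinus (transps (σ a) Bs) ⊗ single σ
  oneMinus-transps-conj {σ} bσ a Bs σ-fixes = single-⊗-conj σ {oneMinus (transps a Bs)} {oneMinus (transps (σ a) Bs)}
    ((≈-refl , (λ _ → refl)) ∷ conj-transps Bs σ-fixes)
    where
    open CommutativeRing K using () renaming (refl to ≈-refl)
    conj-transps : ∀ Bs → (∀ b → b ∈ Bs → σ b ≡ b) → Pointwise (ConjugateTerms σ) (neg (transps a Bs)) (neg (transps (σ a) Bs))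
    conj-transps []       _       = []
    conj-transps (b ∷ Bs) σ-fixes = (≈-refl , λ i → sym (trans (cong (λ v → transp (σ a) v (σ i)) (sym (σ-fixes b (here refl))))
                                                               (transp-conj σ (invertible⇒injective bσ) a b i)))
                                    ∷ conj-transps Bs (λ b′ → σ-fixes b′ ∘ there)

  -- A q 𝔟(X) = A (qx y) q 𝔟(X) = A q (x y) 𝔟(X) = - A q 𝔟(X)
  ⊗-single-⊗-𝔟-vanishes : ∀ {½} → (1# + 1#) * ½ ≈ 1# → ∀ {A} → AllPerms Invertible A → ∀ {X x y q} →
    x ∈ X → y ∈ X → x ≢ y → Invertible q → q y ≡ y → Absorbs A (transp (q x) y) → A ⊗ (single q ⊗ 𝔟 X) ≋ []
  ⊗-single-⊗-𝔟-vanishes 2½≈1 {A} bA {X} {x} {y} {q} x∈X y∈X x≢y bq qy≡y A-absorbs = ≋neg⇒≋[] 2½≈1 (A ⊗ (single q ⊗ 𝔟 X)) (begin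
    A ⊗ (single q ⊗ 𝔟 X)                ≈⟨ ⊗-congˡ {A ⊗ single τ′} {A} (single q ⊗ 𝔟 X) bq𝔟 A-absorbs ⟨
    (A ⊗ single τ′) ⊗ (single q ⊗ 𝔟 X)  ≈⟨ ⊗-assoc A (single τ′) (single q ⊗ 𝔟 X) ⟨
    A ⊗ (single τ′ ⊗ (single q ⊗ 𝔟 X))  ≈⟨ ⊗-congʳ A bA (⊗-assoc (single τ′) (single q) (𝔟 X)) ⟩
    A ⊗ ((single τ′ ⊗ single q) ⊗ 𝔟 X)  ≈⟨ ⊗-congʳ A bA (⊗-congˡ {single τ′ ⊗ single q} {single q ⊗ single τ} (𝔟 X) b𝔟
                                              (≋-pointwise {single τ′ ⊗ single q} {single q ⊗ single τ} ((≈-refl , τ′q≗qτ) ∷ []))) ⟩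
    A ⊗ ((single q ⊗ single τ) ⊗ 𝔟 X)   ≈⟨ ⊗-congʳ A bA (⊗-assoc (single q) (single τ) (𝔟 X)) ⟨
    A ⊗ (single q ⊗ (single τ ⊗ 𝔟 X))   ≈⟨ ⊗-congʳ A bA (⊗-congʳ (single q) {single τ ⊗ 𝔟 X} {neg (𝔟 X)} (bq ∷ []) (transp-⊗-𝔟 x∈X y∈X x≢y)) ⟩
    A ⊗ (single q ⊗ neg (𝔟 X))          ≈⟨ ⊗-congʳ A bA (⊗-neg (single q) (𝔟 X)) ⟩
    A ⊗ neg (single q ⊗ 𝔟 X)            ≈⟨ ⊗-neg A (single q ⊗ 𝔟 X) ⟩
    neg (A ⊗ (single q ⊗ 𝔟 X))          ∎)
    where
    open CommutativeRing K using () renaming (refl to ≈-refl)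
    τ τ′ : Perm
    τ  = transp x y
    τ′ = transp (q x) y
    τ′q≗qτ : τ′ ∘ q ≗ q ∘ τ
    τ′q≗qτ i = trans (cong (λ v → transp (q x) v (q i)) (sym qy≡y)) (transp-conj q (invertible⇒injective bq) x y i)
    b𝔟 : AllPerms Invertible (𝔟 X)
    b𝔟 = AllPerms-invertible-𝔟 X
    bq𝔟 : AllPerms Invertible (single q ⊗ 𝔟 X)
    bq𝔟 = AllPerms-invertible-⊗ (single q) (𝔟 X) (bq ∷ []) b𝔟

  ⊗-absorbed-⊗ : ∀ {A} → AllPerms Invertible A → ∀ R {Y} → AllPerms Invertible Y → AllPerms (Absorbs A) R →
                 A ⊗ Y ≋ [] → A ⊗ (R ⊗ Y) ≋ []
  ⊗-absorbed-⊗ {A} bA R {Y} bY A-absorbs AY≋[] = ⊗-middle-vanishes A R Y (All.map (λ {(_ , ρ)} A-absorbs-ρ → begin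
    A ⊗ (single ρ ⊗ Y)   ≈⟨ ⊗-assoc A (single ρ) Y ⟩
    (A ⊗ single ρ) ⊗ Y   ≈⟨ ⊗-congˡ {A ⊗ single ρ} {A} Y bY A-absorbs-ρ ⟩
    A ⊗ Y                ≈⟨ AY≋[] ⟩
    []                   ∎) A-absorbs)

  Cancels : GA → List (Fin n) → Fin n → Perm → Set ℓ
  Cancels A C d q = (∀ b → b ∈ C → q b ≡ b) × ∃ λ b′ → b′ ∈ C × Absorbs A (transp (q d) b′)

  ⊗-⊗-𝔟-vanishes : ∀ {½} → (1# + 1#) * ½ ≈ 1# → ∀ {A} → AllPerms Invertible A → ∀ {C d} → d ∉ C →
    ∀ Q → AllPerms Invertible Q → AllPerms (Cancels A C d) Q → A ⊗ (Q ⊗ 𝔟 (d ∷ C)) ≋ []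
  ⊗-⊗-𝔟-vanishes 2½≈1 {A} bA {C} {d} d∉C Q bQ cancels = ⊗-middle-vanishes A Q (𝔟 (d ∷ C)) (All.zipWith
    (λ {(_ , q)} (bq , (q-fixes , b′ , b′∈C , absorbs)) →
       ⊗-single-⊗-𝔟-vanishes 2½≈1 bA (here refl) (there b′∈C) (λ d≡b′ → d∉C (subst (_∈ C) (sym d≡b′) b′∈C))
         bq (q-fixes b′ b′∈C) absorbs)
    (bQ , cancels))

  ⊗-columns-vanishes : ∀ {½} → (1# + 1#) * ½ ≈ 1# → ∀ {A} → AllPerms Invertible A →
    ∀ C → Unique C → ∀ {d} → d ∉ C → ∀ Cs Q → AllPerms Invertible Q → AllPerms (Cancels A C d) Q → Cs ≋ Q ⊗ 𝔟 C →
    A ⊗ (Cs ⊗ oneMinus (transps d C)) ≋ []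
  ⊗-columns-vanishes 2½≈1 {A} bA C C-unique {d} d∉C Cs Q bQ cancels Cs≋Q𝔟 = begin
    A ⊗ (Cs ⊗ M)              ≈⟨ ⊗-congʳ A bA (⊗-congˡ {Cs} {Q ⊗ 𝔟 C} M (AllPerms-invertible-oneMinus-transps d C) Cs≋Q𝔟) ⟩
    A ⊗ ((Q ⊗ 𝔟 C) ⊗ M)       ≈⟨ ⊗-congʳ A bA (⊗-assoc Q (𝔟 C) M) ⟨
    A ⊗ (Q ⊗ (𝔟 C ⊗ M))       ≈⟨ ⊗-congʳ A bA (⊗-congʳ Q {𝔟 C ⊗ M} {𝔟 (d ∷ C)} bQ (Coset.coset C C-unique d d∉C)) ⟩
    A ⊗ (Q ⊗ 𝔟 (d ∷ C))       ≈⟨ ⊗-⊗-𝔟-vanishes 2½≈1 bA d∉C Q bQ cancels ⟩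
    []                        ∎
    where
    M : GA
    M = oneMinus (transps d C)

  -- The row factor is absorbed by A, σ moves (1 - ∑ (a b)) to (1 - ∑ (σa b)) on the left,
  -- and the column factor then vanishes against it.
  symmetrizer-vanishes : ∀ {½} → (1# + 1#) * ½ ≈ 1# → ∀ {A} → AllPerms Invertible A →
    ∀ C → Unique C → ∀ R Cs Q → AllPerms Invertible R → AllPerms (Absorbs A) R → AllPerms Invertible Cs →
    ∀ {σ} → Invertible σ → (∀ b → b ∈ C → σ b ≡ b) → ∀ a → σ a ∉ C →
    AllPerms Invertible Q → AllPerms (Cancels A C (σ a)) Q → Cs ≋ Q ⊗ 𝔟 C →
    ((A ⊗ (R ⊗ Cs)) ⊗ single σ) ⊗ oneMinus (transps a C) ≋ []
  symmetrizer-vanishes 2½≈1 {A} bA C C-unique R Cs Q bR R-absorbed bCs {σ} bσ σ-fixes a σa∉C bQ cancels Cs≋Q𝔟 = begin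
    ((A ⊗ (R ⊗ Cs)) ⊗ single σ) ⊗ Mᵃ   ≈⟨ ⊗-assoc (A ⊗ (R ⊗ Cs)) (single σ) Mᵃ ⟨
    (A ⊗ (R ⊗ Cs)) ⊗ (single σ ⊗ Mᵃ)   ≈⟨ ⊗-congʳ (A ⊗ (R ⊗ Cs)) bARCs (oneMinus-transps-conj bσ a C σ-fixes) ⟩
    (A ⊗ (R ⊗ Cs)) ⊗ (Mᵈ ⊗ single σ)   ≈⟨ ⊗-assoc (A ⊗ (R ⊗ Cs)) Mᵈ (single σ) ⟩
    ((A ⊗ (R ⊗ Cs)) ⊗ Mᵈ) ⊗ single σ   ≈⟨ ⊗-[] {(A ⊗ (R ⊗ Cs)) ⊗ Mᵈ} (single σ) (bσ ∷ []) (begin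
      (A ⊗ (R ⊗ Cs)) ⊗ Mᵈ                 ≈⟨ ⊗-assoc A (R ⊗ Cs) Mᵈ ⟨
      A ⊗ ((R ⊗ Cs) ⊗ Mᵈ)                 ≈⟨ ⊗-congʳ A bA (⊗-assoc R Cs Mᵈ) ⟨
      A ⊗ (R ⊗ (Cs ⊗ Mᵈ))                 ≈⟨ ⊗-absorbed-⊗ bA R bCsMᵈ R-absorbed
                                              (⊗-columns-vanishes 2½≈1 bA C C-unique σa∉C Cs Q bQ cancels Cs≋Q𝔟) ⟩
      []                                  ∎) ⟩
    []                                 ∎
    where
    Mᵃ Mᵈ : GA
    Mᵃ = oneMinus (transps a C)
    Mᵈ = oneMinus (transps (σ a) C)
    bARCs : AllPerms Invertible (A ⊗ (R ⊗ Cs))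
    bARCs = AllPerms-invertible-⊗ A (R ⊗ Cs) bA (AllPerms-invertible-⊗ R Cs bR bCs)
    bCsMᵈ : AllPerms Invertible (Cs ⊗ Mᵈ)
    bCsMᵈ = AllPerms-invertible-⊗ Cs Mᵈ bCs (AllPerms-invertible-oneMinus-transps (σ a) C)

module _ {A : Set} where

  nth-∈ : ∀ k (r : List A) {x} → nth k r ≡ just x → x ∈ r
  nth-∈ (suc zero)    (y ∷ r) e = here (sym (just-injective e))
  nth-∈ (suc (suc k)) (y ∷ r) e = there (nth-∈ (suc k) r e)

  nth-defined : ∀ k (r : List A) → 1 ≤ k → k ≤ length r → ∃ λ x → nth k r ≡ just x
  nth-defined (suc zero)    (y ∷ r) _ _         = y , refl
  nth-defined (suc (suc k)) (y ∷ r) _ (s≤s k≤r) = nth-defined (suc k) r (s≤s z≤n) k≤r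

  nth-defined⇒≤length : ∀ k (r : List A) {x} → nth k r ≡ just x → k ≤ length r
  nth-defined⇒≤length (suc zero)    (y ∷ r) _ = s≤s z≤n
  nth-defined⇒≤length (suc (suc k)) (y ∷ r) e = s≤s (nth-defined⇒≤length (suc k) r e)

  ∈⇒nth : ∀ (r : List A) {x} → x ∈ r → ∃ λ k → 1 ≤ k × nth k r ≡ just x
  ∈⇒nth (y ∷ r) (here refl) = 1 , s≤s z≤n , refl
  ∈⇒nth (y ∷ r) (there x∈r) with ∈⇒nth r x∈r
  ... | suc k , _ , e = suc (suc k) , s≤s z≤n , e

  nth-injective : ∀ (r : List A) → Unique r → ∀ k k′ {x} → nth k r ≡ just x → nth k′ r ≡ just x → k ≡ k′
  nth-injective (y ∷ r) _          (suc zero)    (suc zero)     _ _  = refl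
  nth-injective (y ∷ r) (y∉r ∷ _)  (suc zero)    (suc (suc k′)) e e′ = ⊥-elim (All.lookup y∉r (nth-∈ (suc k′) r e′) (just-injective e))
  nth-injective (y ∷ r) (y∉r ∷ _)  (suc (suc k)) (suc zero)     e e′ = ⊥-elim (All.lookup y∉r (nth-∈ (suc k) r e) (just-injective e′))
  nth-injective (y ∷ r) (_ ∷ r-unique) (suc (suc k)) (suc (suc k′)) e e′ = cong suc (nth-injective r r-unique (suc k) (suc k′) e e′)

  ∈-col⁻ : ∀ k (S : List (List A)) {x} → x ∈ col k S → ∃ λ r → r ∈ S × nth k r ≡ just x
  ∈-col⁻ k (r ∷ S) x∈ with nth k r in e
  ∈-col⁻ k (r ∷ S) (here refl)  | just y = r , here refl , e
  ∈-col⁻ k (r ∷ S) (there x∈)   | just y with ∈-col⁻ k S x∈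
  ... | r′ , r′∈S , e′ = r′ , there r′∈S , e′
  ∈-col⁻ k (r ∷ S) x∈           | nothing with ∈-col⁻ k S x∈
  ... | r′ , r′∈S , e′ = r′ , there r′∈S , e′

  ∈-col⁺ : ∀ k (S : List (List A)) {r x} → r ∈ S → nth k r ≡ just x → x ∈ col k S
  ∈-col⁺ k (r ∷ S) (here refl) e rewrite e = here refl
  ∈-col⁺ k (r′ ∷ S) (there r∈S) e with nth k r′
  ... | just _  = there (∈-col⁺ k S r∈S e)
  ... | nothing = ∈-col⁺ k S r∈S e

  col⊆concat : ∀ k (S : List (List A)) {x} → x ∈ col k S → x ∈ concat S
  col⊆concat k S x∈ with ∈-col⁻ k S x∈
  ... | r , r∈S , e = ∈-concat⁺′ (nth-∈ k r e) r∈S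

  concat⊆cols : ∀ (S : List (List A)) {x} → x ∈ concat S → ∃ λ k → 1 ≤ k × x ∈ col k S
  concat⊆cols S x∈ with ∈-concat⁻′ S x∈
  ... | r , x∈r , r∈S with ∈⇒nth r x∈r
  ... | k , 1≤k , e = k , 1≤k , ∈-col⁺ k S r∈S e

  col-unique : ∀ k (S : List (List A)) → Unique (concat S) → Unique (col k S)
  col-unique k []      _ = []
  col-unique k (r ∷ S) S-unique with nth k r in e | Unique-++⁻ r S-unique
  ... | nothing | _ , rest-unique , _     = col-unique k S rest-unique
  ... | just y  | _ , rest-unique , r#S = All.tabulate (λ y′∈ y≡y′ → r#S (nth-∈ k r e , subst (_∈ concat S) (sym y≡y′) (col⊆concat k S y′∈)))
                                          ∷ col-unique k S rest-unique

  col-disjoint : ∀ (S : List (List A)) → Unique (concat S) → ∀ {k k′ x} → x ∈ col k S → x ∈ col k′ S → k ≡ k′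
  col-disjoint S S-unique {k} {k′} x∈ x∈′ with ∈-col⁻ k S x∈ | ∈-col⁻ k′ S x∈′
  ... | r , r∈S , e | r′ , r′∈S , e′ = same-row S S-unique r∈S r′∈S
    where
    same-row : ∀ S → Unique (concat S) → r ∈ S → r′ ∈ S → k ≡ k′
    same-row (_ ∷ S) u (here refl) (here refl) = nth-injective r (proj₁ (Unique-++⁻ r u)) k k′ e e′
    same-row (_ ∷ S) u (here refl) (there r′∈S) =
      ⊥-elim (proj₂ (proj₂ (Unique-++⁻ r u)) (nth-∈ k r e , ∈-concat⁺′ (nth-∈ k′ r′ e′) r′∈S))
    same-row (_ ∷ S) u (there r∈S) (here refl) =
      ⊥-elim (proj₂ (proj₂ (Unique-++⁻ r′ u)) (nth-∈ k′ r′ e′ , ∈-concat⁺′ (nth-∈ k r e) r∈S))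
    same-row (r₀ ∷ S) u (there r∈S) (there r′∈S) = same-row S (proj₁ (proj₂ (Unique-++⁻ r₀ u))) r∈S r′∈S

  addBox-∈⁻ : ∀ u (a : A) S {x} → x ∈ concat (addBox u a S) → x ≡ a ⊎ x ∈ concat S
  addBox-∈⁻ zero          a S       x∈ = inj₂ x∈
  addBox-∈⁻ (suc zero)    a []      (here refl) = inj₁ refl
  addBox-∈⁻ (suc zero)    a (r ∷ S) x∈ with ∈-++⁻ (r ++ a ∷ []) x∈
  ... | inj₂ x∈S = inj₂ (∈-++⁺ʳ r x∈S)
  ... | inj₁ x∈ra with ∈-++⁻ r x∈ra
  ...   | inj₁ x∈r        = inj₂ (∈-++⁺ˡ x∈r)
  ...   | inj₂ (here x≡a) = inj₁ x≡a
  addBox-∈⁻ (suc (suc u)) a (r ∷ S) x∈ with ∈-++⁻ r x∈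
  ... | inj₁ x∈r = inj₂ (∈-++⁺ˡ x∈r)
  ... | inj₂ x∈T with addBox-∈⁻ (suc u) a S x∈T
  ...   | inj₁ x≡a  = inj₁ x≡a
  ...   | inj₂ x∈S  = inj₂ (∈-++⁺ʳ r x∈S)

  addBox-unique : ∀ u (a : A) S → Unique (concat S) → a ∉ concat S → Unique (concat (addBox u a S))
  addBox-unique zero          a S       S-unique a∉S = S-unique
  addBox-unique (suc zero)    a []      _        _   = [] ∷ []
  addBox-unique (suc zero)    a (r ∷ S) S-unique a∉S with Unique-++⁻ r S-unique
  ... | r-unique , rest-unique , r#S = Uniqueₚ.++⁺ (Uniqueₚ.++⁺ r-unique ([] ∷ []) λ { (x∈r , here refl) → a∉S (∈-++⁺ˡ x∈r) })
    rest-unique λ { (x∈ra , x∈S) → case ∈-++⁻ r x∈ra of λ where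
                      (inj₁ x∈r)         → r#S (x∈r , x∈S)
                      (inj₂ (here refl)) → a∉S (∈-++⁺ʳ r x∈S) }
  addBox-unique (suc (suc u)) a []      _        _   = []
  addBox-unique (suc (suc u)) a (r ∷ S) S-unique a∉S with Unique-++⁻ r S-unique
  ... | r-unique , rest-unique , r#S = Uniqueₚ.++⁺ r-unique (addBox-unique (suc u) a S rest-unique (a∉S ∘ ∈-++⁺ʳ r))
    λ { (x∈r , x∈T) → case addBox-∈⁻ (suc u) a S x∈T of λ where
          (inj₁ refl) → a∉S (∈-++⁺ˡ x∈r)
          (inj₂ x∈S)  → r#S (x∈r , x∈S) }

  addBox-⊇row : ∀ u (a : A) S {R} → R ∈ S → ∃ λ R′ → R′ ∈ addBox u a S × (∀ {x} → x ∈ R → x ∈ R′)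
  addBox-⊇row zero          a S       R∈S          = _ , R∈S , id
  addBox-⊇row (suc zero)    a (r ∷ S) (here refl)  = r ++ a ∷ [] , here refl , ∈-++⁺ˡ
  addBox-⊇row (suc zero)    a (r ∷ S) (there R∈S)  = _ , there R∈S , id
  addBox-⊇row (suc (suc u)) a (r ∷ S) (here refl)  = r , here refl , id
  addBox-⊇row (suc (suc u)) a (r ∷ S) (there R∈S) with addBox-⊇row (suc u) a S R∈S
  ... | R′ , R′∈T , R⊆R′ = R′ , there R′∈T , R⊆R′

  addBox-row : ∀ u (a : A) S {r} → nth u S ≡ just r → (r ++ a ∷ []) ∈ addBox u a S
  addBox-row (suc zero)    a (r′ ∷ S) e rewrite just-injective e = here refl
  addBox-row (suc (suc u)) a (r′ ∷ S) e = there (addBox-row (suc u) a S e)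

  rowLen⇒nth : ∀ u (S : List (List A)) → 1 ≤ rowLen u S → ∃ λ r → nth u S ≡ just r × rowLen u S ≡ length r
  rowLen⇒nth u S 1≤len with nth u S
  ... | just r = r , refl , refl

-- The tableau T = S + box (u , v) with entry a

module AddedBox {c ℓ} (K : CommutativeRing c ℓ) {n : ℕ} (S : List (List (Fin n))) (a : Fin n) (u : ℕ)
  (S-unique : Unique (concat S)) (a∉S : a ∉ concat S) (covered : ∀ x → x ≡ a ⊎ x ∈ concat S)
  (j : ℕ) (1≤j : 1 ≤ j) (j<v : j < suc (rowLen u S))
  (σ : Fin n → Fin n) (σ-injective : Injective _≡_ _≡_ σ)
  (σ-fixes : ∀ k → 1 ≤ k → k < suc (rowLen u S) → ∀ b → b ∈ col k S → σ b ≡ b) where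

  open GroupAlgebra K n
  open GroupAlgebraProperties K n
  open Symmetrizers K n
  open import Relation.Binary.Reasoning.Setoid ≋-setoid

  T : List (List (Fin n))
  T = addBox u a S

  T-unique : Unique (concat T)
  T-unique = addBox-unique u a S S-unique a∉S

  C : List (Fin n)
  C = col j S

  a∉col : ∀ k → a ∉ col k S
  a∉col k = a∉S ∘ col⊆concat k S

  σa∉C : σ a ∉ C
  σa∉C σa∈C = a∉col j (subst (_∈ C) (σ-injective (σ-fixes j 1≤j j<v (σ a) σa∈C)) σa∈C)

  Good : Fin n → Set
  Good e = e ≡ a ⊎ ∃ λ k → j < k × e ∈ col k S

  -- σ fixes the columns before v, so σa cannot lie in one of them
  good-σa : Good (σ a)
  good-σa with covered (σ a)
  ... | inj₁ σa≡a = inj₁ σa≡a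
  ... | inj₂ σa∈S with concat⊆cols S σa∈S
  ...   | k , 1≤k , σa∈col with k ℕ.<? suc (rowLen u S)
  ...     | yes k<v = ⊥-elim (a∉S (subst (_∈ concat S) (σ-injective (σ-fixes k 1≤k k<v (σ a) σa∈col)) σa∈S))
  ...     | no k≮v  = inj₂ (k , ℕₚ.<-≤-trans j<v (ℕₚ.≮⇒≥ k≮v) , σa∈col)

  -- a good entry shares a row of T with the entry of column j
  good-absorbs : ∀ {e} → Good e → ∃ λ b′ → b′ ∈ C × Absorbs (𝔞row T) (transp e b′)
  good-absorbs (inj₁ refl) with rowLen⇒nth u S (ℕₚ.≤-trans 1≤j (ℕ.s≤s⁻¹ j<v))
  ... | r , row-u , len-r with nth-defined j r 1≤j (subst (j ≤_) len-r (ℕ.s≤s⁻¹ j<v))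
  ... | b′ , r[j] = b′ , ∈-col⁺ j S (nth-∈ u S row-u) r[j] ,
    𝔞row-absorbs T T-unique (addBox-row u a S row-u) (transp-InSym (∈-++⁺ʳ r (here refl)) (∈-++⁺ˡ (nth-∈ j r r[j])))
  good-absorbs {e} (inj₂ (k , j<k , e∈col)) with ∈-col⁻ k S e∈col
  ... | r , r∈S , r[k] with nth-defined j r 1≤j (ℕₚ.≤-trans (ℕₚ.<⇒≤ j<k) (nth-defined⇒≤length k r r[k]))
  ... | b′ , r[j] with addBox-⊇row u a S r∈S
  ... | R′ , R′∈T , r⊆R′ = b′ , ∈-col⁺ j S r∈S r[j] ,
    𝔞row-absorbs T T-unique R′∈T (transp-InSym (r⊆R′ (nth-∈ k r r[k])) (r⊆R′ (nth-∈ j r r[j])))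

  rows-absorbed : AllPerms (Absorbs (𝔞row T)) (𝔞row S)
  rows-absorbed = All.map proj₁ (AllPerms-prod
    (λ (Af , bf) (Ah , bh) → Absorbs-∘ (AllPerms-invertible-𝔞row T) bh Af Ah , ∘-invertible bf bh)
    (Absorbs-id (𝔞row T) , id-invertible) (map 𝔞 S) (Allₚ.map⁺ (All.tabulate (λ {R} R∈S →
      let R′ , R′∈T , R⊆R′ = addBox-⊇row u a S R∈S in
      All.map (λ ρ∈ → 𝔞row-absorbs T T-unique R′∈T (InSym-⊆ R⊆R′ ρ∈) , InSym⇒invertible ρ∈) (AllPerms-InSym-𝔞 R)))))

  Preserves : Perm → Set
  Preserves q = Invertible q × (∀ x → x ∈ C → q x ≡ x) × (∀ x → Good x → Good (q x))

  Preserves-∘ : ∀ {f h} → Preserves f → Preserves h → Preserves (f ∘ h)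
  Preserves-∘ {f} (bf , f-fixes , f-good) (bh , h-fixes , h-good) =
    ∘-invertible bf bh , (λ x x∈C → trans (cong f (h-fixes x x∈C)) (f-fixes x x∈C)) , (λ x → f-good _ ∘ h-good x)

  Preserves-id : Preserves id
  Preserves-id = id-invertible , (λ _ _ → refl) , (λ _ → id)

  Preserves⇒Cancels : ∀ {q} → Preserves q → Cancels (𝔞row T) C (σ a) q
  Preserves⇒Cancels (_ , q-fixes , q-good) = q-fixes , good-absorbs (q-good (σ a) good-σa)

  other-column-preserves : ∀ {k} → k ≢ j → AllPerms Preserves (𝔟 (col k S))
  other-column-preserves {k} k≢j = All.map (λ f∈ → InSym⇒invertible f∈ ,
      (λ x x∈C → fixed f∈ x (λ x∈col → k≢j (col-disjoint S S-unique x∈col x∈C))) , good f∈) (AllPerms-InSym-𝔟 (col k S))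
    where
    good : ∀ {f} → InSym (col k S) f → ∀ x → Good x → Good (f x)
    good f∈ x (inj₁ refl) = inj₁ (fixed f∈ x (a∉col k))
    good f∈ x (inj₂ (k′ , j<k′ , x∈col′)) with x ∈? col k S
    ... | yes x∈col = inj₂ (k , subst (j <_) (col-disjoint S S-unique x∈col′ x∈col) j<k′ , InSym-stable f∈ x∈col)
    ... | no x∉col  = inj₂ (k′ , j<k′ , subst (_∈ col k′ S) (sym (fixed f∈ x x∉col)) x∈col′)

  columns : List ℕ → GA
  columns ks = prod (map (λ k → 𝔟 (col k S)) ks)

  -- 𝔟(C) commutes with the other column antisymmetrizers, whose supports avoid C.
  columns-split : ∀ ks → Unique ks → j ∈ ks → ∃ λ Q → columns ks ≋ Q ⊗ 𝔟 C × AllPerms Preserves Q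
  columns-split (k ∷ ks) (k∉ks ∷ _) (here refl) = columns ks , ⊗-comm (𝔟 C) (columns ks) (All.map (λ ρ∈ →
      All.map (λ (bq , q-fixes , _) i → InSym-commute ρ∈ (invertible⇒injective bq) q-fixes i) rest-preserves)
      (AllPerms-InSym-𝔟 C)) , rest-preserves
    where
    rest-preserves : AllPerms Preserves (columns ks)
    rest-preserves = AllPerms-prod Preserves-∘ Preserves-id (map (λ k → 𝔟 (col k S)) ks)
      (Allₚ.map⁺ (All.map (λ k≢k′ → other-column-preserves (k≢k′ ∘ sym)) k∉ks))
  columns-split (k ∷ ks) (k∉ks ∷ ks-unique) (there j∈ks) with columns-split ks ks-unique j∈ks
  ... | Q , split , Q-preserves = 𝔟 (col k S) ⊗ Q , split′ ,
    AllPerms-⊗ Preserves-∘ (𝔟 (col k S)) Q (other-column-preserves (All.lookup k∉ks j∈ks)) Q-preserves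
    where
    split′ : columns (k ∷ ks) ≋ (𝔟 (col k S) ⊗ Q) ⊗ 𝔟 C
    split′ = begin
      𝔟 (col k S) ⊗ columns ks      ≈⟨ ⊗-congʳ (𝔟 (col k S)) (AllPerms-invertible-𝔟 (col k S)) split ⟩
      𝔟 (col k S) ⊗ (Q ⊗ 𝔟 C)       ≈⟨ ⊗-assoc (𝔟 (col k S)) Q (𝔟 C) ⟩
      (𝔟 (col k S) ⊗ Q) ⊗ 𝔟 C       ∎

  AllPerms-invertible-columns : ∀ ks → AllPerms Invertible (columns ks)
  AllPerms-invertible-columns ks = AllPerms-prod ∘-invertible id-invertible (map (λ k → 𝔟 (col k S)) ks)
    (Allₚ.map⁺ (All.tabulate (λ {k} _ → AllPerms-invertible-𝔟 (col k S))))

two-invertible : ∀ {c ℓ} (K : CommutativeRing c ℓ) → IsField K → CharZero K →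
                 let open CommutativeRing K in ∃ λ ½ → (1# + 1#) * ½ ≈ 1#
two-invertible K (_ , inverse) char0 =
  let ½ , 2½≈1 = inverse (1# + (1# + 0#)) (char0 1) in ½ , ≈-trans (*-congʳ (+-congˡ (≈-sym (+-identityʳ 1#)))) 2½≈1
  where open CommutativeRing K renaming (trans to ≈-trans; sym to ≈-sym)

permutation-invertible : ∀ {n} (σ : Permutation′ n) → Invertible (σ ⟨$⟩ʳ_)
permutation-invertible σ = invertible (σ ⟨$⟩ˡ_) (λ _ → inverseʳ σ) (λ _ → inverseˡ σ)

∈-upTo-suc : ∀ {j m} → 1 ≤ j → j ≤ m → j ∈ map suc (upTo m)
∈-upTo-suc {suc j} _ j<m = ∈-map⁺ suc (∈-upTo⁺ j<m)

lemma4p4 : ∀ {c ℓ} (K : CommutativeRing c ℓ) → IsField K → CharZero K →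
    (n : ℕ) (S : List (List (Fin n))) (a : Fin n) (u : ℕ) →
    IsPartition (shape S) →
    Unique (concat S) → a ∉ concat S → (∀ x → x ≡ a ⊎ x ∈ concat S) →
    1 ≤ u → u ≤ suc (length S) →
    IsPartition (shape (addBox u a S)) →
    (j : ℕ) → 1 ≤ j → j ≤ firstPart (shape S) → j < suc (rowLen u S) →
    (σ : Permutation′ n) →
    (∀ k → 1 ≤ k → k < suc (rowLen u S) → ∀ b → b ∈ col k S → σ ⟨$⟩ʳ b ≡ b) →
    GroupAlgebra.IsZero K n
      (GroupAlgebra._⊗_ K n
        (GroupAlgebra._⊗_ K n
          (GroupAlgebra._⊗_ K n (GroupAlgebra.𝔞row K n (addBox u a S)) (GroupAlgebra.𝔠 K n S))
          (GroupAlgebra.single K n (σ ⟨$⟩ʳ_)))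
        (GroupAlgebra.oneMinus K n (GroupAlgebra.z K n a j S)))
lemma4p4 K isField char0 n S a u _ S-unique a∉S covered _ _ _ j 1≤j j≤μ₁ j<v σ σ-fixes =
  symmetrizer-vanishes (proj₂ (two-invertible K isField char0)) (AllPerms-invertible-𝔞row T) C (col-unique j S S-unique)
    (𝔞row S) (columns ks) Q (AllPerms-invertible-𝔞row S) rows-absorbed (AllPerms-invertible-columns ks)
    bσ (σ-fixes j 1≤j j<v) a σa∉C (All.map proj₁ Q-preserves) (All.map Preserves⇒Cancels Q-preserves) split
  where
  open GroupAlgebra K n
  open GroupAlgebraProperties K n
  open Symmetrizers K n
  bσ = permutation-invertible σ
  open AddedBox K S a u S-unique a∉S covered j 1≤j j<v (σ ⟨$⟩ʳ_) (invertible⇒injective bσ) σ-fixes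
  ks : List ℕ
  ks = map suc (upTo (firstPart (shape S)))
  split-columns = columns-split ks (Uniqueₚ.map⁺ ℕₚ.suc-injective (Uniqueₚ.upTo⁺ _)) (∈-upTo-suc 1≤j j≤μ₁)
  Q = proj₁ split-columns
  split = proj₁ (proj₂ split-columns)
  Q-preserves = proj₂ (proj₂ split-columns)
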